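{- Let $\Gamma=(X,E)$ be $J(n,k)$ (with $2k\le n$), $J_q(n,k)$, or $H(n,2)$, with diameter $d$. For every $x\in X$, $$x_*=\mathbf{A}(\iota_x)+a_d^{d-1}\,\iota_x .$$
   Context: Graphs: (J) Johnson $J(n,k)$, $2k\le n$: vertices the $k$-subsets of $[n]$, adjacent iff $|x\cap y|=k-1$; $d=k$. (G) Grassmann $J_q(n,k)$: vertices the $k$-dimensional subspaces of an $n$-dimensional vector space over the field with $q$ elements, adjacent iff $\dim(x\cap y)=k-1$; $d=k$. (H) Hypercube $H(n,2)$: vertices $\{1,-1\}^n$, adjacent iff differ in exactly one coordinate; $d=n$. Lattice levels: (J) $\Omega_\ell$ = $\ell$-subsets of $[n]$ ordered by inclusion; (G) $\Omega_\ell$ = $\ell$-dimensional subspaces ordered by inclusion; (H) $\Omega_\ell$ = pairs $(I_x,J_x)$ of disjoint subsets of $[n]$ with $|I_x\cup J_x|=\ell$, $x\le y$ iff $I_x\subseteq I_y$ and $J_x\subseteq J_y$, $\Omega_n$ identified with $X$. In all cases $\Omega_d=X$. $w$ covers $v$ if $v<w$ with nothing strictly between. $\iota_z(y)=1$ if $z\le y$, else $0$; $x_*=\sum_{v:\ x\text{ covers }v}\iota_v$. $\mathbf{A}$ is the adjacency operator $\mathbf{A}(f)(x)=\sum_{y\in X:\ y \text{ adjacent to } x}f(y)$. For $w\in\Omega_d$, $a_d^{d-1}=|\{y\in\Omega_{d-1}:y\le w\}|$. -}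

module Defs where

open import Data.Bool using (Bool; true; false; _∧_; _∨_; not; if_then_else_)
import Data.Bool.Properties as BoolP
open import Data.Nat using (ℕ; zero; suc; _+_; _*_; _≤_; _≡ᵇ_)
open import Data.List using (List; []; _∷_; map; upTo; concatMap; length)
open import Data.Bool.ListAction using (any; all)
open import Data.Nat.ListAction using (sum)
open import Data.List.Membership.Propositional using (_∈_)
open import Data.List.Relation.Unary.Unique.Propositional using (Unique)
open import Data.Vec using (Vec; []; _∷_; zipWith; toList; replicate; foldr)
open import Data.Vec.Properties using (≡-dec)
open import Data.Fin.Subset using (Subset; _∩_; _∪_; ∣_∣; ⊥)
open import Data.Fin.Subset.Properties using (_⊆?_)
open import Data.Sign using (Sign)
import Data.Sign.Properties as SignP
open import Data.Product using (_×_; _,_; ∃)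
open import Relation.Binary.PropositionalEquality using (_≡_)
open import Relation.Binary.Definitions using (DecidableEquality)
open import Relation.Nullary using (¬_)
open import Relation.Nullary.Decidable using (⌊_⌋)
open import Algebra.Structures using (IsCommutativeRing)

allVecs : {A : Set} → List A → (ℓ : ℕ) → List (Vec A ℓ)
allVecs xs zero    = [] ∷ []
allVecs xs (suc ℓ) = concatMap (λ a → map (a ∷_) (allVecs xs ℓ)) xs

bools : List Bool
bools = true ∷ false ∷ []

allSubsets : (n : ℕ) → List (Subset n)
allSubsets n = allVecs bools n

-- A finite "graded" carrier: the lattice Ω is the union of the levels
-- Ω_ℓ (ℓ ≤ d), given as Boolean predicates on a finitely enumerated
-- carrier, with a Boolean order relation.

record Graded : Set₁ where
  field
    Carrier  : Set
    elements : List Carrier          -- lists every element of Carrier exactly once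
    level    : ℕ → Carrier → Bool    -- level ℓ u = true  iff  u ∈ Ω_ℓ
    _≤ᵇ_     : Carrier → Carrier → Bool

module Lattice (P : Graded) (d : ℕ) (adj : Graded.Carrier P → Graded.Carrier P → Bool) where
  open Graded P

  -- Ω = Ω_0 ∪ … ∪ Ω_d ;  X = Ω_d
  inΩ : Carrier → Bool
  inΩ u = any (λ ℓ → level ℓ u) (upTo (suc d))

  inX : Carrier → Bool
  inX = level d

  _<ᵇ_ : Carrier → Carrier → Bool
  v <ᵇ w = (v ≤ᵇ w) ∧ not (w ≤ᵇ v)

  covers : Carrier → Carrier → Bool
  covers w v = inΩ v ∧ (v <ᵇ w) ∧ all (λ u → not (inΩ u ∧ (v <ᵇ u) ∧ (u <ᵇ w))) elements

  ι : Carrier → Carrier → ℕ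
  ι z y = if z ≤ᵇ y then 1 else 0

  sumOver : (Carrier → ℕ) → ℕ
  sumOver f = sum (map f elements)

  _* : Carrier → Carrier → ℕ
  (x *) y = sumOver (λ v → if covers x v then ι v y else 0)

  A : (Carrier → ℕ) → Carrier → ℕ
  A f x = sumOver (λ y → if inX y ∧ adj y x then f y else 0)

  -- a_d^{d-1} for w ∈ Ω_d : #{ y ∈ Ω_{d-1} : y ≤ w }   (Ω_{-1} = ∅)
  countBelow : ℕ → Carrier → ℕ
  countBelow zero    w = 0
  countBelow (suc e) w = sumOver (λ y → if level e y ∧ (y ≤ᵇ w) then 1 else 0)

  a : Carrier → ℕ
  a = countBelow d

  Claim : Set
  Claim = ∀ x y → inX x ≡ true → inX y ≡ true →
          (x *) y ≡ A (ι x) y + a x * ι x y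

JohnsonΩ : ℕ → Graded
JohnsonΩ n = record
  { Carrier  = Subset n
  ; elements = allSubsets n
  ; level    = λ ℓ x → ∣ x ∣ ≡ᵇ ℓ
  ; _≤ᵇ_     = λ x y → ⌊ x ⊆? y ⌋
  }

johnsonAdj : (n k : ℕ) → Subset n → Subset n → Bool
johnsonAdj n k x y = suc ∣ x ∩ y ∣ ≡ᵇ k

HypercubeΩ : ℕ → Graded
HypercubeΩ n = record
  { Carrier  = Subset n × Subset n
  ; elements = concatMap (λ I → map (I ,_) (allSubsets n)) (allSubsets n)
  ; level    = λ { ℓ (I , J) → ⌊ ≡-dec BoolP._≟_ (I ∩ J) ⊥ ⌋ ∧ (∣ I ∪ J ∣ ≡ᵇ ℓ) }
  ; _≤ᵇ_     = λ { (I , J) (I′ , J′) → ⌊ I ⊆? I′ ⌋ ∧ ⌊ J ⊆? J′ ⌋ }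
  }

-- identification Ω_n ≅ {1,-1}^n :  x_i = 1 if i ∈ I_x, x_i = -1 if i ∈ J_x
toSigns : {n : ℕ} → Subset n → Vec Sign n
toSigns []           = []
toSigns (true  ∷ I) = Sign.+ ∷ toSigns I
toSigns (false ∷ I) = Sign.- ∷ toSigns I

differences : {n : ℕ} → Vec Sign n → Vec Sign n → ℕ
differences u v = foldr (λ _ → ℕ) _+_ 0 (zipWith (λ s t → if ⌊ SignP._≟_ s t ⌋ then 0 else 1) u v)

hypercubeAdj : (n : ℕ) → Subset n × Subset n → Subset n × Subset n → Bool
hypercubeAdj n (I , J) (I′ , J′) = differences (toSigns I) (toSigns I′) ≡ᵇ 1

record FiniteField : Set₁ where
  field
    F    : Set
    _+F_ : F → F → F
    _·F_ : F → F → F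
    -F_  : F → F
    0F   : F
    1F   : F
    isCommutativeRing : IsCommutativeRing _≡_ _+F_ _·F_ -F_ 0F 1F
    0≢1     : ¬ (0F ≡ 1F)
    inverse : ∀ x → ¬ (x ≡ 0F) → ∃ λ y → x ·F y ≡ 1F
    _≟F_    : DecidableEquality F
    elemsF   : List F
    completeF : ∀ x → x ∈ elemsF
    uniqueF   : Unique elemsF

module Grassmann (𝔽 : FiniteField) (n : ℕ) where
  open FiniteField 𝔽

  q : ℕ
  q = length elemsF

  V : Set
  V = Vec F n

  vectors : List V
  vectors = allVecs elemsF n

  N : ℕ
  N = length vectors

  _≟V_ : DecidableEquality V
  _≟V_ = ≡-dec _≟F_

  _+V_ : V → V → V
  _+V_ = zipWith _+F_

  _·V_ : F → V → V
  c ·V v = Data.Vec.map (c ·F_) v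

  0V : V
  0V = replicate n 0F

  -- a subset S of V, encoded as a Vec Bool N: the i-th vector of
  -- 'vectors' lies in S iff the i-th bit is true
  SubsetV : Set
  SubsetV = Vec Bool N

  mem : V → SubsetV → Bool
  mem v S = any (λ { (u , b) → ⌊ u ≟V v ⌋ ∧ b }) (toList (Data.Vec.zip (Data.Vec.fromList vectors) S))

  isSubspace : SubsetV → Bool
  isSubspace S = mem 0V S ∧
    all (λ u → not (mem u S) ∨
      all (λ w → not (mem w S) ∨ mem (u +V w) S) vectors ∧
      all (λ c → mem (c ·V u) S) elemsF) vectors

  lincomb : {ℓ : ℕ} → Vec F ℓ → Vec V ℓ → V
  lincomb []       []       = 0V
  lincomb (c ∷ cs) (v ∷ vs) = (c ·V v) +V lincomb cs vs

  linIndependent : {ℓ : ℕ} → Vec V ℓ → Bool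
  linIndependent {ℓ} vs =
    all (λ cs → not ⌊ lincomb cs vs ≟V 0V ⌋ ∨ ⌊ ≡-dec _≟F_ cs (replicate ℓ 0F) ⌋) (allVecs elemsF ℓ)

  spans : {ℓ : ℕ} → Vec V ℓ → SubsetV → Bool
  spans {ℓ} vs S =
    all (λ u → not (mem u S) ∨ any (λ cs → ⌊ lincomb cs vs ≟V u ⌋) (allVecs elemsF ℓ)) vectors

  hasDim : ℕ → SubsetV → Bool
  hasDim ℓ S = isSubspace S ∧
    any (λ vs → all (λ v → mem v S) (toList vs) ∧ linIndependent vs ∧ spans vs S)
        (allVecs vectors ℓ)

  GrassmannΩ : Graded
  GrassmannΩ = record
    { Carrier  = SubsetV
    ; elements = allVecs bools N
    ; level    = hasDim
    ; _≤ᵇ_     = λ S T → ⌊ S ⊆? T ⌋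
    }

  grassmannAdj : ℕ → SubsetV → SubsetV → Bool
  grassmannAdj zero    x y = false
  grassmannAdj (suc j) x y = hasDim j (x ∩ y)

JohnsonClaim : ℕ → ℕ → Set
JohnsonClaim n k = Lattice.Claim (JohnsonΩ n) k (johnsonAdj n k)

GrassmannClaim : FiniteField → ℕ → ℕ → Set
GrassmannClaim 𝔽 n k = Lattice.Claim (Grassmann.GrassmannΩ 𝔽 n) k (Grassmann.grassmannAdj 𝔽 n k)

HypercubeClaim : ℕ → Set
HypercubeClaim n = Lattice.Claim (HypercubeΩ n) n (hypercubeAdj n)

module Submission where

-- Call v a facet of x if v ∈ Ω_{d-1} and v ≤ x.  Module FacetIdentity proves the
-- identity for any finite graded poset with meets _⊓_ whose levels are monotone and
-- which has a one-step extension property: an element of Ω_j strictly below a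
-- "closed" w extends to an element of Ω_{j+1} below w.  Then the lower covers of a
-- vertex x are exactly its facets, so x_*(y) counts the facets of x below y.  For
-- y = x this is a_d^{d-1}; for y ≠ x every such facet equals x ⊓ y, so the count is
-- 1 or 0 according as x ⊓ y is a facet of x, i.e. as x and y are adjacent.
--
-- The three graphs are instances: the meet is x ∩ y for J(n,k), the componentwise
-- intersection of sign patterns for H(n,2), and the intersection of subspaces for
-- J_q(n,k), where monotonicity of levels is the invariance of dimension (proved by
-- counting linear combinations) and the extension step enlarges a basis.

open import Defs
open import Data.Bool using (Bool)
open import Data.Nat using (ℕ; _*_; _≤_)
open import Data.Product using (_×_; _,_)

module Reflection where

  open import Data.Bool using (Bool; true; false; _∧_; _∨_; not)
  open import Data.Bool.Properties using (T-≡)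
  open import Data.Bool.ListAction using (any; all)
  open import Data.List using (List)
  open import Data.List.Membership.Propositional using (_∈_; find; lose)
  open import Data.List.Relation.Unary.Any.Properties using (any⁺; any⁻)
  open import Data.List.Relation.Unary.All.Properties using (all⁺; all⁻)
  import Data.List.Relation.Unary.All as All
  open import Data.Product using (_×_; _,_; ∃)
  open import Function.Bundles using (module Equivalence)
  open import Relation.Binary.PropositionalEquality using (_≡_; _≢_; refl)
  open import Data.Nat using (_≡ᵇ_)
  open import Data.Nat.Properties using (≡ᵇ⇒≡; ≡⇒≡ᵇ)
  open import Data.Empty using (⊥; ⊥-elim)
  open import Relation.Nullary using (Dec; yes; no)
  open import Relation.Nullary.Decidable using (⌊_⌋)
  open Equivalence using (to; from)

  ∧-true⁻ : ∀ {a b} → a ∧ b ≡ true → a ≡ true × b ≡ true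
  ∧-true⁻ {true} b≡true = refl , b≡true

  ∧-true⁺ : ∀ {a b} → a ≡ true → b ≡ true → a ∧ b ≡ true
  ∧-true⁺ refl b≡true = b≡true

  ⇒-true⁻ : ∀ {a b} → not a ∨ b ≡ true → a ≡ true → b ≡ true
  ⇒-true⁻ b≡true refl = b≡true

  ⇒-true⁺ : ∀ a {b} → (a ≡ true → b ≡ true) → not a ∨ b ≡ true
  ⇒-true⁺ true  imp = imp refl
  ⇒-true⁺ false imp = refl

  not-true⁻ : ∀ {a} → not a ≡ true → a ≡ false
  not-true⁻ {false} _ = refl

  true≢false : ∀ {a} → a ≡ true → a ≡ false → ∀ {P : Set} → P
  true≢false refl ()

  ≢true⇒false : ∀ {a} → (a ≡ true → ⊥) → a ≡ false
  ≢true⇒false {false} _     = refl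
  ≢true⇒false {true}  a≢true = ⊥-elim (a≢true refl)

  dec-true⁻ : ∀ {P : Set} (P? : Dec P) → ⌊ P? ⌋ ≡ true → P
  dec-true⁻ (yes p) _ = p

  dec-true⁺ : ∀ {P : Set} (P? : Dec P) → P → ⌊ P? ⌋ ≡ true
  dec-true⁺ (yes _)  _ = refl
  dec-true⁺ (no ¬p) p = ⊥-elim (¬p p)

  ≡ᵇ-true⁻ : ∀ {m n} → (m ≡ᵇ n) ≡ true → m ≡ n
  ≡ᵇ-true⁻ {m} {n} h = ≡ᵇ⇒≡ m n (from T-≡ h)

  ≡ᵇ-true⁺ : ∀ {m n} → m ≡ n → (m ≡ᵇ n) ≡ true
  ≡ᵇ-true⁺ {m} {n} m≡n = to T-≡ (≡⇒≡ᵇ m n m≡n)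

  ≡ᵇ-false⁺ : ∀ {m n} → m ≢ n → (m ≡ᵇ n) ≡ false
  ≡ᵇ-false⁺ m≢n = ≢true⇒false (λ h → m≢n (≡ᵇ-true⁻ h))

  module _ {A : Set} (p : A → Bool) where

    any-true⁺ : ∀ {x xs} → x ∈ xs → p x ≡ true → any p xs ≡ true
    any-true⁺ x∈xs px = to T-≡ (any⁺ p (lose x∈xs (from T-≡ px)))

    any-true⁻ : ∀ xs → any p xs ≡ true → ∃ λ x → x ∈ xs × p x ≡ true
    any-true⁻ xs h with find (any⁻ p xs (from T-≡ h))
    ... | x , x∈xs , px = x , x∈xs , to T-≡ px

    all-true⁺ : ∀ xs → (∀ {x} → x ∈ xs → p x ≡ true) → all p xs ≡ true
    all-true⁺ xs h = to T-≡ (all⁻ p (All.tabulate (λ x∈xs → from T-≡ (h x∈xs))))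

    all-true⁻ : ∀ xs → all p xs ≡ true → ∀ {x} → x ∈ xs → p x ≡ true
    all-true⁻ xs h x∈xs = to T-≡ (All.lookup (all⁺ p xs (from T-≡ h)) x∈xs)

module Sums {A : Set} where

  open import Data.Nat using (_+_)
  open import Data.Nat.Properties using (+-identityʳ)
  open import Data.Nat.ListAction using (sum)
  open import Data.List using (List; []; _∷_; map)
  open import Data.List.Properties using (map-cong)
  open import Data.List.Membership.Propositional using (_∈_)
  open import Data.List.Relation.Unary.Any using (here; there)
  import Data.List.Relation.Unary.All as All
  open import Data.List.Relation.Unary.AllPairs using (_∷_)
  open import Data.List.Relation.Unary.Unique.Propositional using (Unique)
  open import Relation.Binary.PropositionalEquality using (_≡_; _≢_; refl; trans; cong; cong₂)

  sum-cong : ∀ {f g : A → ℕ} → (∀ x → f x ≡ g x) → ∀ xs → sum (map f xs) ≡ sum (map g xs)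
  sum-cong f≗g xs = cong sum (map-cong f≗g xs)

  sum-zero : ∀ (f : A → ℕ) xs → (∀ {x} → x ∈ xs → f x ≡ 0) → sum (map f xs) ≡ 0
  sum-zero f []       _ = refl
  sum-zero f (y ∷ ys) h = cong₂ _+_ (h (here refl)) (sum-zero f ys (λ m → h (there m)))

  sum-single : ∀ (f : A → ℕ) {xs} x → Unique xs → x ∈ xs → (∀ z → z ≢ x → f z ≡ 0) →
               sum (map f xs) ≡ f x
  sum-single f {y ∷ ys} x (y∉ys ∷ _) (here refl) h =
    trans (cong (f y +_) (sum-zero f ys (λ z∈ys → h _ (λ { refl → All.lookup y∉ys z∈ys refl }))))
          (+-identityʳ (f y))
  sum-single f {y ∷ ys} x (y∉ys ∷ uniq) (there x∈ys) h =
    cong₂ _+_ (h y (λ { refl → All.lookup y∉ys x∈ys refl })) (sum-single f x uniq x∈ys h)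

module Enumerations where

  open import Data.Bool using (true; false)
  open import Data.Nat using (zero; suc; _+_; _^_; z≤n; s≤s)
  open import Data.Nat.Properties using (≤-trans; ≤-reflexive; +-suc)
  open import Data.Fin using (zero; suc)
  open import Data.Fin.Subset using (Subset)
  open import Data.List using (List; []; _∷_; map; concatMap; _++_; length; cartesianProductWith)
  open import Data.List.Properties using (length-++; length-map)
  open import Data.List.Membership.Propositional using (_∈_)
  open import Data.List.Membership.Propositional.Properties
    using (∈-cartesianProductWith⁺; ∈-∃++; ∈-++⁻; ∈-++⁺ˡ; ∈-++⁺ʳ)
  open import Data.List.Relation.Unary.Any using (here; there)
  import Data.List.Relation.Unary.All as All
  open import Data.List.Relation.Unary.AllPairs using ([]; _∷_)
  open import Data.List.Relation.Unary.Unique.Propositional using (Unique)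
  open import Data.List.Relation.Unary.Unique.Propositional.Properties using (cartesianProductWith⁺)
  open import Data.Vec using (Vec; []; _∷_; lookup; fromList)
  open import Data.Product using (_×_; _,_; ∃)
  open import Data.Sum using (inj₁; inj₂)
  open import Data.Empty using (⊥-elim)
  open import Relation.Binary.PropositionalEquality using (_≡_; refl; sym; trans; cong; cong₂)

  module _ {A B C : Set} (f : A → B → C) where

    concatMap≡cartesianProductWith : ∀ xs ys →
      concatMap (λ a → map (f a) ys) xs ≡ cartesianProductWith f xs ys
    concatMap≡cartesianProductWith []       ys = refl
    concatMap≡cartesianProductWith (x ∷ xs) ys = cong (map (f x) ys ++_) (concatMap≡cartesianProductWith xs ys)

    product-complete : ∀ xs ys {a b} → a ∈ xs → b ∈ ys → f a b ∈ concatMap (λ a → map (f a) ys) xs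
    product-complete xs ys a∈xs b∈ys rewrite concatMap≡cartesianProductWith xs ys =
      ∈-cartesianProductWith⁺ f a∈xs b∈ys

    product-unique : ∀ xs ys → (∀ {w x y z} → f w y ≡ f x z → w ≡ x × y ≡ z) →
                     Unique xs → Unique ys → Unique (concatMap (λ a → map (f a) ys) xs)
    product-unique xs ys f-injective uxs uys rewrite concatMap≡cartesianProductWith xs ys =
      cartesianProductWith⁺ f f-injective uxs uys

    length-product : ∀ xs ys → length (concatMap (λ a → map (f a) ys) xs) ≡ length xs * length ys
    length-product []       ys = refl
    length-product (x ∷ xs) ys =
      trans (length-++ (map (f x) ys)) (cong₂ _+_ (length-map (f x) ys) (length-product xs ys))

  module _ {A : Set} where

    allVecs-complete : ∀ (xs : List A) → (∀ a → a ∈ xs) → ∀ ℓ (v : Vec A ℓ) → v ∈ allVecs xs ℓ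
    allVecs-complete xs complete zero    []      = here refl
    allVecs-complete xs complete (suc ℓ) (a ∷ v) =
      product-complete _∷_ xs (allVecs xs ℓ) (complete a) (allVecs-complete xs complete ℓ v)

    allVecs-unique : ∀ (xs : List A) → Unique xs → ∀ ℓ → Unique (allVecs xs ℓ)
    allVecs-unique xs uniq zero    = All.[] ∷ []
    allVecs-unique xs uniq (suc ℓ) =
      product-unique _∷_ xs (allVecs xs ℓ) ∷-injective uniq (allVecs-unique xs uniq ℓ)
      where
        ∷-injective : ∀ {w x : A} {y z : Vec A ℓ} → w ∷ y ≡ x ∷ z → w ≡ x × y ≡ z
        ∷-injective refl = refl , refl

    length-allVecs : ∀ (xs : List A) ℓ → length (allVecs xs ℓ) ≡ length xs ^ ℓ
    length-allVecs xs zero    = refl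
    length-allVecs xs (suc ℓ) =
      trans (length-product _∷_ xs (allVecs xs ℓ)) (cong (length xs *_) (length-allVecs xs ℓ))

    unique-length-≤ : ∀ (xs ys : List A) → Unique xs → (∀ {x} → x ∈ xs → x ∈ ys) →
                      length xs ≤ length ys
    unique-length-≤ []       ys _             _   = z≤n
    unique-length-≤ (x ∷ xs) ys (x∉xs ∷ uniq) sub with ∈-∃++ (sub (here refl))
    ... | as , bs , refl =
      ≤-trans (s≤s (unique-length-≤ xs (as ++ bs) uniq sub′)) (≤-reflexive (sym length-removed))
      where
        sub′ : ∀ {z} → z ∈ xs → z ∈ as ++ bs
        sub′ {z} z∈xs with ∈-++⁻ as (sub (there z∈xs))
        ... | inj₁ z∈as         = ∈-++⁺ˡ z∈as
        ... | inj₂ (here refl)  = ⊥-elim (All.lookup x∉xs z∈xs refl)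
        ... | inj₂ (there z∈bs) = ∈-++⁺ʳ as z∈bs
        length-removed : length (as ++ x ∷ bs) ≡ suc (length (as ++ bs))
        length-removed = trans (length-++ as) (trans (+-suc (length as) (length bs)) (cong suc (sym (length-++ as))))

    lookup-fromList-∈ : ∀ (xs : List A) i → lookup (fromList xs) i ∈ xs
    lookup-fromList-∈ (x ∷ xs) zero    = here refl
    lookup-fromList-∈ (x ∷ xs) (suc i) = there (lookup-fromList-∈ xs i)

    lookup-fromList-injective : ∀ (xs : List A) → Unique xs → ∀ i j →
                                lookup (fromList xs) i ≡ lookup (fromList xs) j → i ≡ j
    lookup-fromList-injective (x ∷ xs) _          zero    zero    _ = refl
    lookup-fromList-injective (x ∷ xs) (x∉xs ∷ _) zero    (suc j) e =
      ⊥-elim (All.lookup x∉xs (lookup-fromList-∈ xs j) e)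
    lookup-fromList-injective (x ∷ xs) (x∉xs ∷ _) (suc i) zero    e =
      ⊥-elim (All.lookup x∉xs (lookup-fromList-∈ xs i) (sym e))
    lookup-fromList-injective (x ∷ xs) (_ ∷ uniq) (suc i) (suc j) e =
      cong suc (lookup-fromList-injective xs uniq i j e)

    lookup-fromList-surjective : ∀ (xs : List A) {v} → v ∈ xs → ∃ λ i → lookup (fromList xs) i ≡ v
    lookup-fromList-surjective (x ∷ xs) (here refl) = zero , refl
    lookup-fromList-surjective (x ∷ xs) (there v∈xs) with lookup-fromList-surjective xs v∈xs
    ... | i , e = suc i , e

  bools-complete : ∀ b → b ∈ bools
  bools-complete true  = here refl
  bools-complete false = there (here refl)

  bools-unique : Unique bools
  bools-unique = ((λ ()) All.∷ All.[]) ∷ (All.[] ∷ [])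

  allSubsets-complete : ∀ n (p : Subset n) → p ∈ allSubsets n
  allSubsets-complete n = allVecs-complete bools bools-complete n

  allSubsets-unique : ∀ n → Unique (allSubsets n)
  allSubsets-unique = allVecs-unique bools bools-unique

module FacetIdentity (P : Graded) (d : ℕ) (adj : Graded.Carrier P → Graded.Carrier P → Bool) where

  open import Data.Bool using (Bool; true; false; _∧_; not; if_then_else_)
  open import Data.Bool.Properties using (⇔→≡)
  open import Data.Nat using (zero; suc; _+_; _<_; s≤s; s≤s⁻¹)
  open import Data.Nat.Properties
    using (≤-trans; n≤1+n; 1+n≰n; <⇒≤; ≤∧≢⇒<; m≤n⇒m<n∨m≡n; *-identityʳ; *-zeroʳ; +-identityʳ)
  open import Data.List using (upTo)
  open import Data.List.Membership.Propositional.Properties using (∈-upTo⁺; ∈-upTo⁻)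
  open import Data.List.Membership.Propositional using (_∈_)
  open import Data.List.Relation.Unary.Unique.Propositional using (Unique)
  open import Data.Product using (∃; proj₁)
  open import Data.Sum using (inj₁; inj₂)
  open import Data.Empty using (⊥; ⊥-elim)
  open import Function.Bundles using (mk⇔)
  open import Relation.Binary.PropositionalEquality
  open import Relation.Binary.Definitions using (DecidableEquality)
  open import Relation.Nullary using (yes; no)
  open Graded P
  open Lattice P d adj
  open Reflection
  open Sums

  facetAt : ℕ → Carrier → Carrier → Bool
  facetAt zero    x v = false
  facetAt (suc e) x v = level e v ∧ (v ≤ᵇ x)

  facet : Carrier → Carrier → Bool
  facet = facetAt d

  facetAt⁻ : ∀ ℓ {x v} → facetAt ℓ x v ≡ true →
             ∃ λ e → ℓ ≡ suc e × level e v ≡ true × v ≤ᵇ x ≡ true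
  facetAt⁻ (suc e) {x} {v} h = let (le , v≤x) = ∧-true⁻ {level e v} h in e , refl , le , v≤x

  facetAt⁺ : ∀ ℓ e {x v} → ℓ ≡ suc e → level e v ≡ true → v ≤ᵇ x ≡ true → facetAt ℓ x v ≡ true
  facetAt⁺ .(suc e) e refl le v≤x = ∧-true⁺ le v≤x

  inΩ⁻ : ∀ {u} → inΩ u ≡ true → ∃ λ i → i ≤ d × level i u ≡ true
  inΩ⁻ {u} h with any-true⁻ (λ ℓ → level ℓ u) (upTo (suc d)) h
  ... | i , i∈upTo , li = i , s≤s⁻¹ (∈-upTo⁻ i∈upTo) , li

  inΩ⁺ : ∀ {i u} → i ≤ d → level i u ≡ true → inΩ u ≡ true
  inΩ⁺ {u = u} i≤d li = any-true⁺ (λ ℓ → level ℓ u) (∈-upTo⁺ (s≤s i≤d)) li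

  <ᵇ⁺ : ∀ {u w} → u ≤ᵇ w ≡ true → w ≤ᵇ u ≡ false → u <ᵇ w ≡ true
  <ᵇ⁺ u≤w w≰u rewrite u≤w | w≰u = refl

  <ᵇ⁻ : ∀ {u w} → u <ᵇ w ≡ true → u ≤ᵇ w ≡ true × w ≤ᵇ u ≡ false
  <ᵇ⁻ {u} {w} h = let (u≤w , w≰u) = ∧-true⁻ {u ≤ᵇ w} h in u≤w , not-true⁻ w≰u

  indicator : Bool → ℕ
  indicator b = if b then 1 else 0

  facetCount : Carrier → Carrier → ℕ
  facetCount x y = sumOver (λ v → if facet x v then ι v y else 0)

  facetCount-diagonal : ∀ ℓ x → sumOver (λ v → if facetAt ℓ x v then ι v x else 0) ≡ countBelow ℓ x
  facetCount-diagonal zero    x = sum-zero _ elements (λ _ → refl)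
  facetCount-diagonal (suc e) x = sum-cong facet-ι elements
    where
      facet-ι : ∀ v → (if facetAt (suc e) x v then ι v x else 0) ≡ indicator (level e v ∧ (v ≤ᵇ x))
      facet-ι v with level e v | v ≤ᵇ x
      ... | true  | true  = refl
      ... | true  | false = refl
      ... | false | _     = refl

  record MeetConditions : Set₁ where
    field
      elements-unique   : Unique elements
      elements-complete : ∀ u → u ∈ elements
      _≟_               : DecidableEquality Carrier
      ≤ᵇ-refl           : ∀ u → u ≤ᵇ u ≡ true
      ≤ᵇ-trans          : ∀ {u v w} → u ≤ᵇ v ≡ true → v ≤ᵇ w ≡ true → u ≤ᵇ w ≡ true
      ≤ᵇ-antisym        : ∀ {u w} → u ≤ᵇ w ≡ true → w ≤ᵇ u ≡ true → u ≡ w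
      level-mono        : ∀ {i j u w} → level i u ≡ true → level j w ≡ true → u ≤ᵇ w ≡ true → i ≤ j
      Closed            : Carrier → Set
      level-closed      : ∀ {i u} → level i u ≡ true → Closed u
      step              : ∀ {j v w} → level j v ≡ true → Closed w → v <ᵇ w ≡ true →
                          ∃ λ u → level (suc j) u ≡ true × v ≤ᵇ u ≡ true × u ≤ᵇ w ≡ true
      _⊓_               : Carrier → Carrier → Carrier
      ⊓-closed          : ∀ {x y} → Closed x → Closed y → Closed (x ⊓ y)
      ⊓-lowerˡ          : ∀ x y → (x ⊓ y) ≤ᵇ x ≡ true
      ⊓-lowerʳ          : ∀ x y → (x ⊓ y) ≤ᵇ y ≡ true
      ⊓-greatest        : ∀ {v x y} → v ≤ᵇ x ≡ true → v ≤ᵇ y ≡ true → v ≤ᵇ (x ⊓ y) ≡ true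
      adj-irrefl        : ∀ {x} → inX x ≡ true → adj x x ≡ false
      adj-meet          : ∀ {x y} → inX x ≡ true → inX y ≡ true → x ≢ y → adj x y ≡ facet x (x ⊓ y)

  module _ (C : MeetConditions) where
    open MeetConditions C

    level-rigid : ∀ {i u w} → level i u ≡ true → level i w ≡ true → u ≤ᵇ w ≡ true → u ≡ w
    level-rigid {u = u} {w} lu lw u≤w with w ≤ᵇ u in w≤u
    ... | true  = ≤ᵇ-antisym u≤w w≤u
    ... | false with step lu (level-closed lw) (<ᵇ⁺ u≤w w≤u)
    ...   | _ , lu′ , _ , u′≤w = ⊥-elim (1+n≰n (level-mono lu′ lw u′≤w))

    level-strict : ∀ {i j u w} → level i u ≡ true → level j w ≡ true → u <ᵇ w ≡ true → i < j
    level-strict {i} {j} {u} lu lw u<w with <ᵇ⁻ u<w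
    ... | u≤w , w≰u = ≤∧≢⇒< (level-mono lu lw u≤w) same-level
      where
        same-level : i ≢ j
        same-level refl with level-rigid lu lw u≤w
        ... | refl = true≢false (≤ᵇ-refl u) w≰u

    covers⇒facet : ∀ {x v} → inX x ≡ true → covers x v ≡ true → facet x v ≡ true
    covers⇒facet {x} {v} hx h with ∧-true⁻ {inΩ v} h
    ... | v∈Ω , h′ with ∧-true⁻ {v <ᵇ x} h′ | inΩ⁻ v∈Ω
    ... | v<x , nothing-between | i , _ , lv with m≤n⇒m<n∨m≡n (level-strict lv hx v<x)
    ...   | inj₂ 1+i≡d = facetAt⁺ d i (sym 1+i≡d) lv (proj₁ (<ᵇ⁻ v<x))
    ...   | inj₁ 1+i<d with step lv (level-closed hx) v<x
    ...     | u , lu , v≤u , u≤x =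
      true≢false (all-true⁻ _ elements nothing-between (elements-complete u)) u-between
      where
        u≰v : u ≤ᵇ v ≡ false
        u≰v = ≢true⇒false (λ u≤v → 1+n≰n (level-mono lu lv u≤v))
        x≰u : x ≤ᵇ u ≡ false
        x≰u = ≢true⇒false (λ x≤u → 1+n≰n (≤-trans 1+i<d (level-mono hx lu x≤u)))
        u-between : not (inΩ u ∧ (v <ᵇ u) ∧ (u <ᵇ x)) ≡ false
        u-between rewrite inΩ⁺ (<⇒≤ 1+i<d) lu | <ᵇ⁺ v≤u u≰v | <ᵇ⁺ u≤x x≰u = refl

    facet⇒covers : ∀ {x v} → inX x ≡ true → facet x v ≡ true → covers x v ≡ true
    facet⇒covers {x} {v} hx h with facetAt⁻ d h
    ... | e , d≡1+e , lv , v≤x =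
      ∧-true⁺ (inΩ⁺ e≤d lv)
              (∧-true⁺ (<ᵇ⁺ v≤x x≰v) (all-true⁺ _ elements (λ {u} _ → nothing-between u)))
      where
        e≤d : e ≤ d
        e≤d = subst (e ≤_) (sym d≡1+e) (n≤1+n e)
        x≰v : x ≤ᵇ v ≡ false
        x≰v = ≢true⇒false (λ x≤v → 1+n≰n (subst (_≤ e) d≡1+e (level-mono hx lv x≤v)))
        -- a strictly intermediate u would have a level strictly between e and e+1
        nothing-between : ∀ u → not (inΩ u ∧ (v <ᵇ u) ∧ (u <ᵇ x)) ≡ true
        nothing-between u = cong not (≢true⇒false between)
          where
            between : inΩ u ∧ (v <ᵇ u) ∧ (u <ᵇ x) ≡ true → ⊥
            between h with ∧-true⁻ {inΩ u} h
            ... | u∈Ω , h′ with ∧-true⁻ {v <ᵇ u} h′ | inΩ⁻ u∈Ω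
            ... | v<u , u<x | i , _ , lu =
              1+n≰n (≤-trans (level-strict lv lu v<u)
                             (s≤s⁻¹ (subst (i <_) d≡1+e (level-strict lu hx u<x))))

    covers≡facet : ∀ {x v} → inX x ≡ true → covers x v ≡ facet x v
    covers≡facet hx = ⇔→≡ (mk⇔ (covers⇒facet hx) (facet⇒covers hx))

    star≡facetCount : ∀ {x} y → inX x ≡ true → (x *) y ≡ facetCount x y
    star≡facetCount y hx = sum-cong (λ v → cong (λ b → if b then ι v y else 0) (covers≡facet hx)) elements

    ι-vertex : ∀ {x z} → inX x ≡ true → inX z ≡ true → z ≢ x → ι x z ≡ 0
    ι-vertex {x} {z} hx hz z≢x with x ≤ᵇ z in x≤z
    ... | false = refl
    ... | true  = ⊥-elim (z≢x (sym (level-rigid hx hz x≤z)))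

    adjacency-ι : ∀ {x} y → inX x ≡ true → A (ι x) y ≡ indicator (adj x y)
    adjacency-ι {x} y hx = trans (sum-single term x elements-unique (elements-complete x) vanish) at-x
      where
        term : Carrier → ℕ
        term z = if inX z ∧ adj z y then ι x z else 0
        vanish : ∀ z → z ≢ x → term z ≡ 0
        vanish z z≢x with inX z in hz | adj z y
        ... | false | _     = refl
        ... | true  | false = refl
        ... | true  | true  = ι-vertex hx hz z≢x
        at-x : term x ≡ indicator (adj x y)
        at-x rewrite hx | ≤ᵇ-refl x = refl

    -- a facet of x below another vertex y is the meet x ⊓ y: otherwise the
    -- extension step would produce a vertex below both x and y
    facet-below-vertex : ∀ {x y v} → inX x ≡ true → inX y ≡ true → x ≢ y →
                         facet x v ≡ true → v ≤ᵇ y ≡ true → v ≡ x ⊓ y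
    facet-below-vertex {x} {y} {v} hx hy x≢y fv v≤y with facetAt⁻ d fv
    ... | e , d≡1+e , lv , v≤x with (x ⊓ y) ≤ᵇ v in m≤v
    ...   | true  = ≤ᵇ-antisym (⊓-greatest v≤x v≤y) m≤v
    ...   | false
      with step lv (⊓-closed (level-closed hx) (level-closed hy)) (<ᵇ⁺ (⊓-greatest v≤x v≤y) m≤v)
    ...     | u , lu , _ , u≤m = ⊥-elim (x≢y (trans (sym u≡x) u≡y))
      where
        u∈X : inX u ≡ true
        u∈X = subst (λ ℓ → level ℓ u ≡ true) (sym d≡1+e) lu
        u≡x : u ≡ x
        u≡x = level-rigid u∈X hx (≤ᵇ-trans u≤m (⊓-lowerˡ x y))
        u≡y : u ≡ y
        u≡y = level-rigid u∈X hy (≤ᵇ-trans u≤m (⊓-lowerʳ x y))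

    facetCount-offdiagonal : ∀ {x y} → inX x ≡ true → inX y ≡ true → x ≢ y →
                             facetCount x y ≡ indicator (facet x (x ⊓ y))
    facetCount-offdiagonal {x} {y} hx hy x≢y =
      trans (sum-single term (x ⊓ y) elements-unique (elements-complete _) vanish) at-meet
      where
        term : Carrier → ℕ
        term v = if facet x v then ι v y else 0
        vanish : ∀ v → v ≢ x ⊓ y → term v ≡ 0
        vanish v v≢m with facet x v in fv | v ≤ᵇ y in v≤y
        ... | false | _     = refl
        ... | true  | false = refl
        ... | true  | true  = ⊥-elim (v≢m (facet-below-vertex hx hy x≢y fv v≤y))
        at-meet : term (x ⊓ y) ≡ indicator (facet x (x ⊓ y))
        at-meet rewrite ⊓-lowerʳ x y = refl

    facet-identity : Claim
    facet-identity x y hx hy with x ≟ y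
    ... | yes refl = begin
      (x *) x                    ≡⟨ star≡facetCount x hx ⟩
      facetCount x x             ≡⟨ facetCount-diagonal d x ⟩
      a x                        ≡⟨ sym (*-identityʳ (a x)) ⟩
      a x * 1                    ≡⟨ cong (λ b → a x * indicator b) (sym (≤ᵇ-refl x)) ⟩
      0 + a x * ι x x            ≡⟨ cong (_+ a x * ι x x) (sym no-loop) ⟩
      A (ι x) x + a x * ι x x    ∎
      where
        open ≡-Reasoning
        no-loop : A (ι x) x ≡ 0
        no-loop = trans (adjacency-ι x hx) (cong indicator (adj-irrefl hx))
    ... | no x≢y = begin
      (x *) y                        ≡⟨ star≡facetCount y hx ⟩
      facetCount x y                 ≡⟨ facetCount-offdiagonal hx hy x≢y ⟩
      indicator (facet x (x ⊓ y))    ≡⟨ cong indicator (sym (adj-meet hx hy x≢y)) ⟩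
      indicator (adj x y)            ≡⟨ sym (adjacency-ι y hx) ⟩
      A (ι x) y                      ≡⟨ sym (+-identityʳ _) ⟩
      A (ι x) y + 0                  ≡⟨ cong (A (ι x) y +_) (sym a*ι≡0) ⟩
      A (ι x) y + a x * ι x y        ∎
      where
        open ≡-Reasoning
        a*ι≡0 : a x * ι x y ≡ 0
        a*ι≡0 = trans (cong (a x *_) (ι-vertex hx hy (≢-sym x≢y))) (*-zeroʳ (a x))

module SubsetFacts where

  open import Data.Bool using (Bool; true; false)
  open import Data.Nat using (suc)
  open import Data.Fin using (zero; suc)
  open import Data.Fin.Subset using (Subset; _∈_; _∉_; _⊆_; _∩_; _∪_; ⁅_⁆; ∣_∣)
  open import Data.Fin.Subset.Properties
    using (_⊆?_; _∈?_; ⊆-refl; ⊆-trans; ⊆-antisym; x∈p∩q⁺; x∈p∪q⁻; p⊆p∪q; q⊆p∪q; x∈⁅y⁆⇒x≡y;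
           ∪-identityʳ)
  open import Data.Fin.Properties using (¬∀⟶∃¬)
  open import Data.Vec using (_∷_; here; there)
  open import Data.Product using (_×_; _,_; ∃)
  open import Data.Sum using (inj₁; inj₂)
  open import Data.Empty using (⊥-elim)
  open import Function using (_∘_)
  open import Relation.Binary.PropositionalEquality using (_≡_; cong)
  open import Relation.Nullary using (¬_; yes; no)
  open import Relation.Nullary.Decidable using (⌊_⌋; _→-dec_)
  open Reflection

  module _ {n : ℕ} where

    _⊆ᵇ_ : Subset n → Subset n → Bool
    p ⊆ᵇ q = ⌊ p ⊆? q ⌋

    ⊆ᵇ⁻ : ∀ {p q} → p ⊆ᵇ q ≡ true → p ⊆ q
    ⊆ᵇ⁻ {p} {q} = dec-true⁻ (p ⊆? q)

    ⊆ᵇ⁺ : ∀ {p q} → p ⊆ q → p ⊆ᵇ q ≡ true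
    ⊆ᵇ⁺ {p} {q} = dec-true⁺ (p ⊆? q)

    ⊆ᵇ-false⁻ : ∀ {p q} → p ⊆ᵇ q ≡ false → ¬ p ⊆ q
    ⊆ᵇ-false⁻ p⊈q p⊆q = true≢false (⊆ᵇ⁺ p⊆q) p⊈q

    ⊆ᵇ-refl : ∀ p → p ⊆ᵇ p ≡ true
    ⊆ᵇ-refl p = ⊆ᵇ⁺ ⊆-refl

    ⊆ᵇ-trans : ∀ {p q r} → p ⊆ᵇ q ≡ true → q ⊆ᵇ r ≡ true → p ⊆ᵇ r ≡ true
    ⊆ᵇ-trans p⊆q q⊆r = ⊆ᵇ⁺ (⊆-trans (⊆ᵇ⁻ p⊆q) (⊆ᵇ⁻ q⊆r))

    ⊆ᵇ-antisym : ∀ {p q} → p ⊆ᵇ q ≡ true → q ⊆ᵇ p ≡ true → p ≡ q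
    ⊆ᵇ-antisym p⊆q q⊆p = ⊆-antisym (⊆ᵇ⁻ p⊆q) (⊆ᵇ⁻ q⊆p)

    ⊆-∩ : ∀ {p q r : Subset n} → p ⊆ q → p ⊆ r → p ⊆ q ∩ r
    ⊆-∩ p⊆q p⊆r i∈p = x∈p∩q⁺ (p⊆q i∈p , p⊆r i∈p)

    ⊈-witness : ∀ {p q : Subset n} → ¬ p ⊆ q → ∃ λ i → i ∈ p × i ∉ q
    ⊈-witness {p} {q} p⊈q
      with ¬∀⟶∃¬ n (λ i → i ∈ p → i ∈ q) (λ i → (i ∈? p) →-dec (i ∈? q)) (λ h → p⊈q (λ {i} → h i))
    ... | i , i-escapes with i ∈? p
    ...   | yes i∈p = i , i∈p , (λ i∈q → i-escapes (λ _ → i∈q))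
    ...   | no  i∉p = ⊥-elim (i-escapes (⊥-elim ∘ i∉p))

    ∪-mono : ∀ {p p′ q q′ : Subset n} → p ⊆ p′ → q ⊆ q′ → p ∪ q ⊆ p′ ∪ q′
    ∪-mono {p} {p′} {q} {q′} p⊆p′ q⊆q′ i∈p∪q with x∈p∪q⁻ p q i∈p∪q
    ... | inj₁ i∈p = p⊆p∪q q′ (p⊆p′ i∈p)
    ... | inj₂ i∈q = q⊆p∪q p′ q′ (q⊆q′ i∈q)

    insert-⊆ : ∀ {p q : Subset n} {i} → p ⊆ q → i ∈ q → p ∪ ⁅ i ⁆ ⊆ q
    insert-⊆ {p} {i = i} p⊆q i∈q j∈p∪i with x∈p∪q⁻ p ⁅ i ⁆ j∈p∪i
    ... | inj₁ j∈p = p⊆q j∈p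
    ... | inj₂ j∈i rewrite x∈⁅y⁆⇒x≡y i j∈i = i∈q

  ∣p∪⁅i⁆∣≡1+∣p∣ : ∀ {n} (p : Subset n) {i} → i ∉ p → ∣ p ∪ ⁅ i ⁆ ∣ ≡ suc ∣ p ∣
  ∣p∪⁅i⁆∣≡1+∣p∣ (true  ∷ p) {zero}  i∉p = ⊥-elim (i∉p here)
  ∣p∪⁅i⁆∣≡1+∣p∣ (false ∷ p) {zero}  _   = cong (suc ∘ ∣_∣) (∪-identityʳ p)
  ∣p∪⁅i⁆∣≡1+∣p∣ (true  ∷ p) {suc i} i∉p = cong suc (∣p∪⁅i⁆∣≡1+∣p∣ p (i∉p ∘ there))
  ∣p∪⁅i⁆∣≡1+∣p∣ (false ∷ p) {suc i} i∉p = ∣p∪⁅i⁆∣≡1+∣p∣ p (i∉p ∘ there)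

-- J(n,k): levels are subset sizes, the meet is the intersection.
module JohnsonGraph (n k : ℕ) where

  open import Data.Bool using (true; false; _∧_)
  open import Data.Bool.Properties using (∧-identityʳ) renaming (_≟_ to _≟ᵇ_)
  open import Data.Nat using (suc; zero; _≡ᵇ_)
  open import Data.Nat.Properties using (1+n≢n)
  open import Data.Fin.Subset using (_∩_; _∪_; ⁅_⁆; ∣_∣)
  open import Data.Fin.Subset.Properties using (p⊆q⇒∣p∣≤∣q∣; p⊆p∪q; p∩q⊆p; p∩q⊆q; ∩-idem)
  open import Data.Vec.Properties using (≡-dec)
  open import Data.Unit using (⊤; tt)
  open import Data.Product using (∃; _,_)
  open import Relation.Binary.PropositionalEquality
  open Graded (JohnsonΩ n)
  open Lattice (JohnsonΩ n) k (johnsonAdj n k)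
  open FacetIdentity (JohnsonΩ n) k (johnsonAdj n k)
  open Reflection
  open Enumerations
  open SubsetFacts

  size : ∀ {i} u → level i u ≡ true → ∣ u ∣ ≡ i
  size u = ≡ᵇ-true⁻

  -- add to v one element of w outside v
  step : ∀ {j v w} → level j v ≡ true → v <ᵇ w ≡ true →
         ∃ λ u → level (suc j) u ≡ true × v ≤ᵇ u ≡ true × u ≤ᵇ w ≡ true
  step {j} {v} {w} lv v<w with <ᵇ⁻ v<w
  ... | v⊆w , w⊈v with ⊈-witness (⊆ᵇ-false⁻ w⊈v)
  ... | i , i∈w , i∉v =
    v ∪ ⁅ i ⁆ , ≡ᵇ-true⁺ (trans (∣p∪⁅i⁆∣≡1+∣p∣ v i∉v) (cong suc (size v lv))) ,
    ⊆ᵇ⁺ (p⊆p∪q ⁅ i ⁆) , ⊆ᵇ⁺ (insert-⊆ (⊆ᵇ⁻ v⊆w) i∈w)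

  adjacent⇔meet-facet : ∀ ℓ x y → johnsonAdj n ℓ x y ≡ facetAt ℓ x (x ∩ y)
  adjacent⇔meet-facet zero    x y = refl
  adjacent⇔meet-facet (suc e) x y =
    sym (trans (cong ((∣ x ∩ y ∣ ≡ᵇ e) ∧_) (⊆ᵇ⁺ (p∩q⊆p x y))) (∧-identityʳ _))

  adj-irrefl : ∀ x → inX x ≡ true → johnsonAdj n k x x ≡ false
  adj-irrefl x hx =
    trans (cong (λ m → suc m ≡ᵇ k) (trans (cong ∣_∣ (∩-idem x)) (size x hx))) (≡ᵇ-false⁺ (1+n≢n {k}))

  conditions : MeetConditions
  conditions = record
    { elements-unique   = allSubsets-unique n
    ; elements-complete = allSubsets-complete n
    ; _≟_               = ≡-dec _≟ᵇ_
    ; ≤ᵇ-refl           = ⊆ᵇ-refl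
    ; ≤ᵇ-trans          = ⊆ᵇ-trans
    ; ≤ᵇ-antisym        = ⊆ᵇ-antisym
    ; level-mono        = λ {_} {_} {u} {w} lu lw u⊆w →
                            subst₂ _≤_ (size u lu) (size w lw) (p⊆q⇒∣p∣≤∣q∣ (⊆ᵇ⁻ u⊆w))
    ; Closed            = λ _ → ⊤
    ; level-closed      = λ _ → tt
    ; step              = λ lv _ v<w → step lv v<w
    ; _⊓_               = _∩_
    ; ⊓-closed          = λ _ _ → tt
    ; ⊓-lowerˡ          = λ x y → ⊆ᵇ⁺ (p∩q⊆p x y)
    ; ⊓-lowerʳ          = λ x y → ⊆ᵇ⁺ (p∩q⊆q x y)
    ; ⊓-greatest        = λ v⊆x v⊆y → ⊆ᵇ⁺ (⊆-∩ (⊆ᵇ⁻ v⊆x) (⊆ᵇ⁻ v⊆y))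
    ; adj-irrefl        = λ {x} → adj-irrefl x
    ; adj-meet          = λ {x} {y} _ _ _ → adjacent⇔meet-facet k x y
    }

  johnson : JohnsonClaim n k
  johnson = facet-identity conditions

module SignPatterns where

  open import Data.Bool using (true; false)
  open import Data.Nat using (suc; _+_)
  open import Data.Nat.Properties using (+-suc)
  open import Data.Fin.Subset using (Subset; _∩_; _∪_; ∁; ⊥; ⊤; ∣_∣)
  open import Data.Vec using ([]; _∷_; tail)
  open import Relation.Binary.PropositionalEquality using (_≡_; refl; trans; cong)

  diffs : ∀ {m} → Subset m → Subset m → ℕ
  diffs I I′ = differences (toSigns I) (toSigns I′)

  diffs-refl : ∀ {m} (I : Subset m) → diffs I I ≡ 0
  diffs-refl []          = refl
  diffs-refl (true  ∷ I) = diffs-refl I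
  diffs-refl (false ∷ I) = diffs-refl I

  diffs+agreements : ∀ {m} (I I′ : Subset m) → diffs I I′ + ∣ (I ∩ I′) ∪ (∁ I ∩ ∁ I′) ∣ ≡ m
  diffs+agreements []          []           = refl
  diffs+agreements (true  ∷ I) (true  ∷ I′) = trans (+-suc _ _) (cong suc (diffs+agreements I I′))
  diffs+agreements (false ∷ I) (false ∷ I′) = trans (+-suc _ _) (cong suc (diffs+agreements I I′))
  diffs+agreements (true  ∷ I) (false ∷ I′) = cong suc (diffs+agreements I I′)
  diffs+agreements (false ∷ I) (true  ∷ I′) = cong suc (diffs+agreements I I′)

  complement-unique : ∀ {m} (I J : Subset m) → I ∩ J ≡ ⊥ → I ∪ J ≡ ⊤ → J ≡ ∁ I
  complement-unique []          []          _      _     = refl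
  complement-unique (true  ∷ I) (false ∷ J) I∩J≡⊥ I∪J≡⊤ =
    cong (false ∷_) (complement-unique I J (cong tail I∩J≡⊥) (cong tail I∪J≡⊤))
  complement-unique (false ∷ I) (true  ∷ J) I∩J≡⊥ I∪J≡⊤ =
    cong (true ∷_) (complement-unique I J (cong tail I∩J≡⊥) (cong tail I∪J≡⊤))
  complement-unique (true  ∷ I) (true  ∷ J) ()    _
  complement-unique (false ∷ I) (false ∷ J) _     ()

-- H(n,2): Ω consists of disjoint pairs (I,J) ranked by |I ∪ J|; the meet is
-- the componentwise intersection.
module HypercubeGraph (n : ℕ) where

  open import Data.Bool using (true; false; _∧_)
  open import Data.Bool.Properties using (∧-identityʳ; ⇔→≡) renaming (_≟_ to _≟ᵇ_)
  open import Data.Nat using (suc; zero; _+_; _≡ᵇ_)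
  open import Data.Nat.Properties using (1+n≢0; suc-injective; +-cancelʳ-≡)
  open import Data.Fin.Subset using (_∈_; _∉_; _⊆_; _∩_; _∪_; ∁; ⁅_⁆; ⊥; ∣_∣)
  open import Data.Fin.Subset.Properties
    using (p⊆q⇒∣p∣≤∣q∣; p⊆p∪q; p∩q⊆p; p∩q⊆q; ⊆-refl; ⊆-trans; ⊆-antisym; x∈p∩q⁺; x∈p∩q⁻; x∈p∪q⁻;
           _⊆?_; ∉⊥; Empty-unique; ∣p∣≡n⇒p≡⊤; ∪-assoc; ∪-comm)
  open import Data.Vec.Properties using (≡-dec)
  open import Data.Product using (_×_; _,_; ∃; proj₁; proj₂)
  open import Data.Product.Properties using () renaming (≡-dec to ×-≡-dec)
  open import Data.Sum using (inj₁; inj₂)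
  open import Function.Bundles using (mk⇔)
  open import Relation.Binary.PropositionalEquality
  open import Relation.Nullary.Decidable using (⌊_⌋)
  open Graded (HypercubeΩ n)
  open Lattice (HypercubeΩ n) n (hypercubeAdj n)
  open FacetIdentity (HypercubeΩ n) n (hypercubeAdj n)
  open Reflection
  open Enumerations
  open SubsetFacts
  open SignPatterns

  -- the closed elements are the disjoint pairs; Ω_ℓ consists of those of rank ℓ
  Disjoint : Carrier → Set
  Disjoint (I , J) = I ∩ J ≡ ⊥

  rank : Carrier → ℕ
  rank (I , J) = ∣ I ∪ J ∣

  level⁻ : ∀ {ℓ} u → level ℓ u ≡ true → Disjoint u × rank u ≡ ℓ
  level⁻ (I , J) h = let (disj , size) = ∧-true⁻ h in
    dec-true⁻ (≡-dec _≟ᵇ_ (I ∩ J) ⊥) disj , ≡ᵇ-true⁻ size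

  level⁺ : ∀ {ℓ} u → Disjoint u → rank u ≡ ℓ → level ℓ u ≡ true
  level⁺ (I , J) disj size = ∧-true⁺ (dec-true⁺ (≡-dec _≟ᵇ_ (I ∩ J) ⊥) disj) (≡ᵇ-true⁺ size)

  ≤⁻ : ∀ u w → u ≤ᵇ w ≡ true → proj₁ u ⊆ proj₁ w × proj₂ u ⊆ proj₂ w
  ≤⁻ _ _ h = let (I⊆I′ , J⊆J′) = ∧-true⁻ h in ⊆ᵇ⁻ I⊆I′ , ⊆ᵇ⁻ J⊆J′

  ≤⁺ : ∀ u w → proj₁ u ⊆ proj₁ w → proj₂ u ⊆ proj₂ w → u ≤ᵇ w ≡ true
  ≤⁺ _ _ I⊆I′ J⊆J′ = ∧-true⁺ (⊆ᵇ⁺ I⊆I′) (⊆ᵇ⁺ J⊆J′)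

  rank-mono : ∀ u w → u ≤ᵇ w ≡ true → rank u ≤ rank w
  rank-mono u w u≤w = let (I⊆I′ , J⊆J′) = ≤⁻ u w u≤w in p⊆q⇒∣p∣≤∣q∣ (∪-mono I⊆I′ J⊆J′)

  disjoint-mono : ∀ u w → u ≤ᵇ w ≡ true → Disjoint w → Disjoint u
  disjoint-mono (I , J) w u≤w disj = Empty-unique λ { (i , i∈I∩J) →
    let (I⊆I′ , J⊆J′) = ≤⁻ (I , J) w u≤w ; (i∈I , i∈J) = x∈p∩q⁻ I J i∈I∩J
    in ∉⊥ (subst (i ∈_) disj (x∈p∩q⁺ (I⊆I′ i∈I , J⊆J′ i∈J))) }

  one-step : ∀ {j} v w u → level j v ≡ true → Disjoint w → v ≤ᵇ u ≡ true → u ≤ᵇ w ≡ true →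
             rank u ≡ suc (rank v) → ∃ λ u → level (suc j) u ≡ true × v ≤ᵇ u ≡ true × u ≤ᵇ w ≡ true
  one-step v w u lv disj v≤u u≤w rank-u =
    u , level⁺ u (disjoint-mono u w u≤w disj) (trans rank-u (cong suc (proj₂ (level⁻ v lv)))) , v≤u , u≤w

  -- a new coordinate i of w enters v on the side where w has it
  step : ∀ {j v w} → level j v ≡ true → Disjoint w → v <ᵇ w ≡ true →
         ∃ λ u → level (suc j) u ≡ true × v ≤ᵇ u ≡ true × u ≤ᵇ w ≡ true
  step {v = I , J} {I′ , J′} lv disj v<w with <ᵇ⁻ {I , J} {I′ , J′} v<w
  ... | v≤w , w≰v with ≤⁻ (I , J) (I′ , J′) v≤w | ⌊ I′ ⊆? I ⌋ in I′⊆?I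
  ... | I⊆I′ , J⊆J′ | false with ⊈-witness (⊆ᵇ-false⁻ I′⊆?I)
  ...   | i , i∈I′ , i∉I =
    one-step (I , J) (I′ , J′) (I ∪ ⁅ i ⁆ , J) lv disj
      (≤⁺ (I , J) (I ∪ ⁅ i ⁆ , J) (p⊆p∪q ⁅ i ⁆) ⊆-refl)
      (≤⁺ (I ∪ ⁅ i ⁆ , J) (I′ , J′) (insert-⊆ I⊆I′ i∈I′) J⊆J′)
      (trans (cong ∣_∣ reorder) (∣p∪⁅i⁆∣≡1+∣p∣ (I ∪ J) i∉I∪J))
    where
      reorder : (I ∪ ⁅ i ⁆) ∪ J ≡ (I ∪ J) ∪ ⁅ i ⁆
      reorder = trans (∪-assoc I ⁅ i ⁆ J) (trans (cong (I ∪_) (∪-comm ⁅ i ⁆ J)) (sym (∪-assoc I J ⁅ i ⁆)))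
      i∉I∪J : i ∉ I ∪ J
      i∉I∪J i∈I∪J with x∈p∪q⁻ I J i∈I∪J
      ... | inj₁ i∈I = i∉I i∈I
      ... | inj₂ i∈J = ∉⊥ (subst (i ∈_) disj (x∈p∩q⁺ (i∈I′ , J⊆J′ i∈J)))
  step {v = I , J} {I′ , J′} lv disj v<w | v≤w , w≰v | I⊆I′ , J⊆J′ | true
    with ⊈-witness (⊆ᵇ-false⁻ {p = J′} {q = J} w≰v)
  ...   | i , i∈J′ , i∉J =
    one-step (I , J) (I′ , J′) (I , J ∪ ⁅ i ⁆) lv disj
      (≤⁺ (I , J) (I , J ∪ ⁅ i ⁆) ⊆-refl (p⊆p∪q ⁅ i ⁆))
      (≤⁺ (I , J ∪ ⁅ i ⁆) (I′ , J′) I⊆I′ (insert-⊆ J⊆J′ i∈J′))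
      (trans (cong ∣_∣ (sym (∪-assoc I J ⁅ i ⁆))) (∣p∪⁅i⁆∣≡1+∣p∣ (I ∪ J) i∉I∪J))
    where
      i∉I∪J : i ∉ I ∪ J
      i∉I∪J i∈I∪J with x∈p∪q⁻ I J i∈I∪J
      ... | inj₁ i∈I = ∉⊥ (subst (i ∈_) disj (x∈p∩q⁺ (I⊆I′ i∈I , i∈J′)))
      ... | inj₂ i∈J = i∉J i∈J

  _⊓_ : Carrier → Carrier → Carrier
  x ⊓ y = proj₁ x ∩ proj₁ y , proj₂ x ∩ proj₂ y

  ⊓-lowerˡ : ∀ x y → (x ⊓ y) ≤ᵇ x ≡ true
  ⊓-lowerˡ x y = ≤⁺ (x ⊓ y) x (p∩q⊆p _ _) (p∩q⊆p _ _)

  ⊓-lowerʳ : ∀ x y → (x ⊓ y) ≤ᵇ y ≡ true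
  ⊓-lowerʳ x y = ≤⁺ (x ⊓ y) y (p∩q⊆q _ _) (p∩q⊆q _ _)

  vertex-complement : ∀ I J → inX (I , J) ≡ true → J ≡ ∁ I
  vertex-complement I J hx =
    let (disj , size) = level⁻ (I , J) hx in complement-unique I J disj (∣p∣≡n⇒p≡⊤ size)

  one-difference : ∀ a b e → a + b ≡ suc e → (a ≡ᵇ 1) ≡ (b ≡ᵇ e)
  one-difference a b e a+b≡1+e = ⇔→≡ (mk⇔ a≡1⇒b≡e b≡e⇒a≡1)
    where
      a≡1⇒b≡e : (a ≡ᵇ 1) ≡ true → (b ≡ᵇ e) ≡ true
      a≡1⇒b≡e a≡1 = ≡ᵇ-true⁺ (suc-injective (trans (cong (_+ b) (sym (≡ᵇ-true⁻ a≡1))) a+b≡1+e))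
      b≡e⇒a≡1 : (b ≡ᵇ e) ≡ true → (a ≡ᵇ 1) ≡ true
      b≡e⇒a≡1 b≡e = ≡ᵇ-true⁺ (+-cancelʳ-≡ b a 1 (trans a+b≡1+e (cong suc (sym (≡ᵇ-true⁻ b≡e)))))

  adjacent⇔meet-facet : ∀ ℓ x y → Disjoint (x ⊓ y) → diffs (proj₁ x) (proj₁ y) + rank (x ⊓ y) ≡ ℓ →
                        (diffs (proj₁ x) (proj₁ y) ≡ᵇ 1) ≡ facetAt ℓ x (x ⊓ y)
  adjacent⇔meet-facet zero    x y _    total =
    ≡ᵇ-false⁺ (λ diffs≡1 → 1+n≢0 (trans (cong (_+ rank (x ⊓ y)) (sym diffs≡1)) total))
  adjacent⇔meet-facet (suc e) x y disj total = begin
    (diffs (proj₁ x) (proj₁ y) ≡ᵇ 1)  ≡⟨ one-difference (diffs (proj₁ x) (proj₁ y)) (rank m) e total ⟩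
    (rank m ≡ᵇ e)                     ≡⟨ sym (∧-identityʳ _) ⟩
    (rank m ≡ᵇ e) ∧ true              ≡⟨ cong₂ (λ a b → (a ∧ (rank m ≡ᵇ e)) ∧ b)
                                               (sym m-disjoint) (sym (⊓-lowerˡ x y)) ⟩
    facetAt (suc e) x m               ∎
    where
      open ≡-Reasoning
      m = x ⊓ y
      m-disjoint : ⌊ ≡-dec _≟ᵇ_ (proj₁ m ∩ proj₂ m) ⊥ ⌋ ≡ true
      m-disjoint = dec-true⁺ (≡-dec _≟ᵇ_ (proj₁ m ∩ proj₂ m) ⊥) disj

  adj-meet : ∀ {x y} → inX x ≡ true → inX y ≡ true → hypercubeAdj n x y ≡ facet x (x ⊓ y)
  adj-meet {I , J} {I′ , J′} hx hy with vertex-complement I J hx | vertex-complement I′ J′ hy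
  ... | refl | refl = adjacent⇔meet-facet n x y meet-disjoint (diffs+agreements I I′)
    where
      x = I , ∁ I
      y = I′ , ∁ I′
      meet-disjoint : Disjoint (x ⊓ y)
      meet-disjoint = disjoint-mono (x ⊓ y) x (⊓-lowerˡ x y) (proj₁ (level⁻ x hx))

  conditions : MeetConditions
  conditions = record
    { elements-unique   = product-unique _,_ (allSubsets n) (allSubsets n) (λ { refl → refl , refl })
                            (allSubsets-unique n) (allSubsets-unique n)
    ; elements-complete = λ (I , J) → product-complete _,_ (allSubsets n) (allSubsets n)
                            (allSubsets-complete n I) (allSubsets-complete n J)
    ; _≟_               = ×-≡-dec (≡-dec _≟ᵇ_) (≡-dec _≟ᵇ_)
    ; ≤ᵇ-refl           = λ u → ≤⁺ u u ⊆-refl ⊆-refl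
    ; ≤ᵇ-trans          = λ {u} {v} {w} u≤v v≤w → let (I⊆ , J⊆) = ≤⁻ u v u≤v ; (I⊆′ , J⊆′) = ≤⁻ v w v≤w
                                                  in ≤⁺ u w (⊆-trans I⊆ I⊆′) (⊆-trans J⊆ J⊆′)
    ; ≤ᵇ-antisym        = λ {u} {w} u≤w w≤u → let (I⊆ , J⊆) = ≤⁻ u w u≤w ; (I⊇ , J⊇) = ≤⁻ w u w≤u
                                              in cong₂ _,_ (⊆-antisym I⊆ I⊇) (⊆-antisym J⊆ J⊇)
    ; level-mono        = λ {_} {_} {u} {w} lu lw u≤w →
                            subst₂ _≤_ (proj₂ (level⁻ u lu)) (proj₂ (level⁻ w lw)) (rank-mono u w u≤w)
    ; Closed            = Disjoint
    ; level-closed      = λ {_} {u} lu → proj₁ (level⁻ u lu)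
    ; step              = step
    ; _⊓_               = _⊓_
    ; ⊓-closed          = λ {x} {y} disj _ → disjoint-mono (x ⊓ y) x (⊓-lowerˡ x y) disj
    ; ⊓-lowerˡ          = ⊓-lowerˡ
    ; ⊓-lowerʳ          = ⊓-lowerʳ
    ; ⊓-greatest        = λ {v} {x} {y} v≤x v≤y → let (I⊆ , J⊆) = ≤⁻ v x v≤x ; (I⊆′ , J⊆′) = ≤⁻ v y v≤y
                                                  in ≤⁺ v (x ⊓ y) (⊆-∩ I⊆ I⊆′) (⊆-∩ J⊆ J⊆′)
    ; adj-irrefl        = λ {x} _ → cong (_≡ᵇ 1) (diffs-refl (proj₁ x))
    ; adj-meet          = λ hx hy _ → adj-meet hx hy
    }

  hypercube : HypercubeClaim n
  hypercube = facet-identity conditions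

module Coordinates (𝔽 : FiniteField) where

  open import Level using (0ℓ)
  open import Algebra.Bundles using (CommutativeRing)
  open import Data.Nat using (zero; suc)
  open import Data.Vec using (Vec; []; _∷_; zipWith; map; replicate; head; tail)
  open import Data.Vec.Properties using (zipWith-identityˡ; zipWith-identityʳ)
  open import Relation.Binary.PropositionalEquality using (_≡_; refl; sym; trans; cong; cong₂)
  open FiniteField 𝔽

  field-ring : CommutativeRing 0ℓ 0ℓ
  field-ring = record { isCommutativeRing = isCommutativeRing }

  open CommutativeRing field-ring
    using (+-identityˡ; +-identityʳ; -‿inverseʳ; *-assoc; *-identityˡ; distribˡ; distribʳ; zeroˡ; zeroʳ;
           ring; +-group; +-commutativeSemigroup)
  open import Algebra.Properties.Ring ring using (-1*x≈-x)
  open import Algebra.Properties.Group +-group using (inverseˡ-unique; x∙y⁻¹≈ε⇒x≈y)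
  open import Algebra.Properties.CommutativeSemigroup +-commutativeSemigroup using (interchange)

  -1F : F
  -1F = -F 1F

  infixl 6 _⊕_
  _⊕_ : ∀ {m} → Vec F m → Vec F m → Vec F m
  _⊕_ = zipWith _+F_

  infixr 7 _⊙_
  _⊙_ : ∀ {m} → F → Vec F m → Vec F m
  c ⊙ v = map (c ·F_) v

  𝟘 : ∀ m → Vec F m
  𝟘 m = replicate m 0F

  ⊕-identityˡ : ∀ {m} (v : Vec F m) → 𝟘 m ⊕ v ≡ v
  ⊕-identityˡ = zipWith-identityˡ +-identityˡ

  ⊕-identityʳ : ∀ {m} (v : Vec F m) → v ⊕ 𝟘 m ≡ v
  ⊕-identityʳ = zipWith-identityʳ +-identityʳ

  ⊕-interchange : ∀ {m} (a b c d : Vec F m) → (a ⊕ b) ⊕ (c ⊕ d) ≡ (a ⊕ c) ⊕ (b ⊕ d)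
  ⊕-interchange []       []       []       []       = refl
  ⊕-interchange (a ∷ as) (b ∷ bs) (c ∷ cs) (d ∷ ds) =
    cong₂ _∷_ (interchange a b c d) (⊕-interchange as bs cs ds)

  ⊙-distribˡ : ∀ {m} c (u v : Vec F m) → c ⊙ (u ⊕ v) ≡ c ⊙ u ⊕ c ⊙ v
  ⊙-distribˡ c []      []      = refl
  ⊙-distribˡ c (a ∷ u) (b ∷ v) = cong₂ _∷_ (distribˡ c a b) (⊙-distribˡ c u v)

  ⊙-distribʳ : ∀ {m} a b (v : Vec F m) → (a +F b) ⊙ v ≡ a ⊙ v ⊕ b ⊙ v
  ⊙-distribʳ a b []      = refl
  ⊙-distribʳ a b (x ∷ v) = cong₂ _∷_ (distribʳ x a b) (⊙-distribʳ a b v)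

  ⊙-assoc : ∀ {m} a b (v : Vec F m) → (a ·F b) ⊙ v ≡ a ⊙ (b ⊙ v)
  ⊙-assoc a b []      = refl
  ⊙-assoc a b (x ∷ v) = cong₂ _∷_ (*-assoc a b x) (⊙-assoc a b v)

  ⊙-identity : ∀ {m} (v : Vec F m) → 1F ⊙ v ≡ v
  ⊙-identity []      = refl
  ⊙-identity (x ∷ v) = cong₂ _∷_ (*-identityˡ x) (⊙-identity v)

  ⊙-zeroˡ : ∀ {m} (v : Vec F m) → 0F ⊙ v ≡ 𝟘 m
  ⊙-zeroˡ []      = refl
  ⊙-zeroˡ (x ∷ v) = cong₂ _∷_ (zeroˡ x) (⊙-zeroˡ v)

  ⊙-zeroʳ : ∀ m c → c ⊙ 𝟘 m ≡ 𝟘 m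
  ⊙-zeroʳ zero    c = refl
  ⊙-zeroʳ (suc m) c = cong₂ _∷_ (zeroʳ c) (⊙-zeroʳ m c)

  ⊕-inverse : ∀ {m} (v : Vec F m) → v ⊕ -1F ⊙ v ≡ 𝟘 m
  ⊕-inverse []      = refl
  ⊕-inverse (x ∷ v) = cong₂ _∷_ (trans (cong (x +F_) (-1*x≈-x x)) (-‿inverseʳ x)) (⊕-inverse v)

  ⊕-inverse-unique : ∀ {m} (u v : Vec F m) → u ⊕ v ≡ 𝟘 m → u ≡ -1F ⊙ v
  ⊕-inverse-unique []      []      _   = refl
  ⊕-inverse-unique (a ∷ u) (b ∷ v) u+v≡0 =
    cong₂ _∷_ (trans (inverseˡ-unique a b (cong head u+v≡0)) (sym (-1*x≈-x b)))
              (⊕-inverse-unique u v (cong tail u+v≡0))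

  ⊖-cancel : ∀ {m} (u v : Vec F m) → u ⊕ -1F ⊙ v ≡ 𝟘 m → u ≡ v
  ⊖-cancel []      []      _   = refl
  ⊖-cancel (a ∷ u) (b ∷ v) u-v≡0 =
    cong₂ _∷_ (x∙y⁻¹≈ε⇒x≈y a b (trans (cong (a +F_) (sym (-1*x≈-x b))) (cong head u-v≡0)))
              (⊖-cancel u v (cong tail u-v≡0))

-- J_q(n,k): subspaces of F^n, encoded as subsets of the enumerated vectors.
module GrassmannGraph (𝔽 : FiniteField) (n : ℕ) where

  open import Data.Bool using (Bool; true; false; _∧_; _∨_; not)
  open import Data.Bool.Properties using (∧-identityʳ; ⇔→≡)
  open import Data.Bool.ListAction using (any; all)
  open import Data.Nat using (zero; suc; _^_)
  open import Data.Nat.Properties using (^-monoʳ-<; <⇒≱; ≮⇒≥; 1+n≰n)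
  open import Data.Fin using (Fin; zero; suc)
  open import Data.Fin.Subset using (_∈_; _⊆_; _∩_)
  open import Data.Fin.Subset.Properties using (⊆-refl; x∈p∩q⁺; x∈p∩q⁻; p∩q⊆p; p∩q⊆q; ∩-idem)
  open import Data.List using (List; []; _∷_; length; map)
  open import Data.List.Properties using (length-map)
  import Data.List.Membership.Propositional as List
  open import Data.List.Membership.Propositional.Properties using (∈-map⁺; ∈-map⁻)
  open import Data.List.Relation.Unary.Any using (here; there)
  import Data.List.Relation.Unary.All as All
  open import Data.List.Relation.Unary.AllPairs using ([]; _∷_)
  open import Data.List.Relation.Unary.Unique.Propositional using (Unique)
  open import Data.List.Relation.Unary.Unique.Propositional.Properties using (map⁺)
  open import Data.Vec using (Vec; []; _∷_; lookup; fromList; toList; zip)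
  open import Data.Vec.Properties using (≡-dec; []=⇒lookup; lookup⇒[]=; lookup-map)
  open import Data.Product using (_×_; _,_; ∃; proj₁; proj₂)
  open import Data.Empty using (⊥-elim)
  open import Function using (_∘_)
  open import Function.Bundles using (mk⇔)
  open import Relation.Binary.PropositionalEquality
  open import Relation.Nullary using (¬_; yes; no)
  open import Relation.Nullary.Decidable using (⌊_⌋)
  open import Algebra.Bundles using (module CommutativeRing)
  open FiniteField 𝔽
  open Grassmann 𝔽 n
  open Coordinates 𝔽
  open Reflection
  open Enumerations
  open SubsetFacts

  enumeration : Vec V N
  enumeration = fromList vectors

  vectors-unique : Unique vectors
  vectors-unique = allVecs-unique elemsF uniqueF n

  vectors-complete : ∀ v → v List.∈ vectors
  vectors-complete = allVecs-complete elemsF completeF n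

  position : V → Fin N
  position v = proj₁ (lookup-fromList-surjective vectors (vectors-complete v))

  lookup-position : ∀ v → lookup enumeration (position v) ≡ v
  lookup-position v = proj₂ (lookup-fromList-surjective vectors (vectors-complete v))

  position-lookup : ∀ i → position (lookup enumeration i) ≡ i
  position-lookup i = lookup-fromList-injective vectors vectors-unique _ _ (lookup-position (lookup enumeration i))

  module _ (v : V) (p : V × Bool → Bool) (p-spec : ∀ u b → p (u , b) ≡ ⌊ u ≟V v ⌋ ∧ b) where

    any-zip⁻ : ∀ {m} (ws : Vec V m) S → any p (toList (zip ws S)) ≡ true →
               ∃ λ i → lookup ws i ≡ v × lookup S i ≡ true
    any-zip⁻ []       []      ()
    any-zip⁻ (w ∷ ws) (b ∷ S) h with p (w , b) in pwb
    ... | true  = let (w≡v , b≡true) = ∧-true⁻ (trans (sym (p-spec w b)) pwb)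
                  in zero , dec-true⁻ (w ≟V v) w≡v , b≡true
    ... | false = let (i , wi≡v , Si) = any-zip⁻ ws S h in suc i , wi≡v , Si

    any-zip⁺ : ∀ {m} (ws : Vec V m) S i → lookup ws i ≡ v → lookup S i ≡ true →
               any p (toList (zip ws S)) ≡ true
    any-zip⁺ (w ∷ ws) (b ∷ S) zero    refl b≡true
      rewrite p-spec w b | dec-true⁺ (w ≟V w) refl | b≡true = refl
    any-zip⁺ (w ∷ ws) (b ∷ S) (suc i) wi≡v Si with p (w , b)
    ... | true  = refl
    ... | false = any-zip⁺ ws S i wi≡v Si

  mem-lookup : ∀ v S → mem v S ≡ lookup S (position v)
  mem-lookup v S = ⇔→≡ (mk⇔ mem⇒bit bit⇒mem)
    where
      mem⇒bit : mem v S ≡ true → lookup S (position v) ≡ true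
      mem⇒bit h with any-zip⁻ v _ (λ _ _ → refl) enumeration S h
      ... | i , vi≡v , Si = subst (λ j → lookup S j ≡ true) (sym position≡i) Si
        where position≡i : position v ≡ i
              position≡i = lookup-fromList-injective vectors vectors-unique _ _
                             (trans (lookup-position v) (sym vi≡v))
      bit⇒mem : lookup S (position v) ≡ true → mem v S ≡ true
      bit⇒mem = any-zip⁺ v _ (λ _ _ → refl) enumeration S (position v) (lookup-position v)

  infix 4 _∋_
  _∋_ : SubsetV → V → Set
  S ∋ v = mem v S ≡ true

  ∈⇒∋ : ∀ {S i} → i ∈ S → S ∋ lookup enumeration i
  ∈⇒∋ {S} {i} i∈S = trans (mem-lookup _ S) (trans (cong (lookup S) (position-lookup i)) ([]=⇒lookup i∈S))

  ∋⇒∈ : ∀ {S v} → S ∋ v → position v ∈ S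
  ∋⇒∈ {S} {v} S∋v = lookup⇒[]= (position v) S (trans (sym (mem-lookup v S)) S∋v)

  ∋-⊆ : ∀ {S T v} → S ⊆ T → S ∋ v → T ∋ v
  ∋-⊆ {S} {T} {v} S⊆T S∋v = trans (mem-lookup v T) ([]=⇒lookup (S⊆T (∋⇒∈ S∋v)))

  ⊆-∋ : ∀ {S T} → (∀ {v} → S ∋ v → T ∋ v) → S ⊆ T
  ⊆-∋ {S} {T} S⊆T {i} i∈S = subst (_∈ T) (position-lookup i) (∋⇒∈ (S⊆T (∈⇒∋ i∈S)))

  ∋-∩⁻ : ∀ {S T v} → (S ∩ T) ∋ v → S ∋ v × T ∋ v
  ∋-∩⁻ {S} {T} S∩T∋v = let (i∈S , i∈T) = x∈p∩q⁻ S T (∋⇒∈ S∩T∋v) in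
    trans (mem-lookup _ S) ([]=⇒lookup i∈S) , trans (mem-lookup _ T) ([]=⇒lookup i∈T)

  ∋-∩⁺ : ∀ {S T v} → S ∋ v → T ∋ v → (S ∩ T) ∋ v
  ∋-∩⁺ {S} {T} {v} S∋v T∋v = trans (mem-lookup v (S ∩ T)) ([]=⇒lookup (x∈p∩q⁺ (∋⇒∈ S∋v , ∋⇒∈ T∋v)))

  tabulate : (V → Bool) → SubsetV
  tabulate f = Data.Vec.map f enumeration

  mem-tabulate : ∀ f v → mem v (tabulate f) ≡ f v
  mem-tabulate f v =
    trans (mem-lookup v (tabulate f)) (trans (lookup-map (position v) f enumeration) (cong f (lookup-position v)))

  lincomb-skip : ∀ {ℓ} u (cs : Vec F ℓ) vs → lincomb (0F ∷ cs) (u ∷ vs) ≡ lincomb cs vs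
  lincomb-skip u cs vs = trans (cong (_⊕ lincomb cs vs) (⊙-zeroˡ u)) (⊕-identityˡ (lincomb cs vs))

  lincomb-zero : ∀ {ℓ} (vs : Vec V ℓ) → lincomb (𝟘 ℓ) vs ≡ 0V
  lincomb-zero []       = refl
  lincomb-zero (v ∷ vs) = trans (lincomb-skip v (𝟘 _) vs) (lincomb-zero vs)

  lincomb-add : ∀ {ℓ} (cs ds : Vec F ℓ) vs → lincomb (cs ⊕ ds) vs ≡ lincomb cs vs +V lincomb ds vs
  lincomb-add []       []       []       = sym (⊕-identityˡ 0V)
  lincomb-add (c ∷ cs) (d ∷ ds) (v ∷ vs) = begin
    (c +F d) ⊙ v ⊕ lincomb (cs ⊕ ds) vs                  ≡⟨ cong₂ _⊕_ (⊙-distribʳ c d v) (lincomb-add cs ds vs) ⟩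
    (c ⊙ v ⊕ d ⊙ v) ⊕ (lincomb cs vs ⊕ lincomb ds vs)    ≡⟨ ⊕-interchange _ _ _ _ ⟩
    (c ⊙ v ⊕ lincomb cs vs) ⊕ (d ⊙ v ⊕ lincomb ds vs)    ∎
    where open ≡-Reasoning

  lincomb-scale : ∀ {ℓ} a (cs : Vec F ℓ) vs → lincomb (a ⊙ cs) vs ≡ a ·V lincomb cs vs
  lincomb-scale a []       []       = sym (⊙-zeroʳ n a)
  lincomb-scale a (c ∷ cs) (v ∷ vs) = begin
    (a ·F c) ⊙ v ⊕ lincomb (a ⊙ cs) vs   ≡⟨ cong₂ _⊕_ (⊙-assoc a c v) (lincomb-scale a cs vs) ⟩
    a ⊙ (c ⊙ v) ⊕ a ⊙ lincomb cs vs     ≡⟨ sym (⊙-distribˡ a _ _) ⟩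
    a ⊙ (c ⊙ v ⊕ lincomb cs vs)         ∎
    where open ≡-Reasoning

  lincomb-member : ∀ {ℓ} (vs : Vec V ℓ) {v} → v List.∈ toList vs → ∃ λ cs → lincomb cs vs ≡ v
  lincomb-member (w ∷ vs) (here refl) =
    1F ∷ 𝟘 _ , trans (cong (1F ⊙ w ⊕_) (lincomb-zero vs)) (trans (⊕-identityʳ (1F ⊙ w)) (⊙-identity w))
  lincomb-member (w ∷ vs) (there v∈vs) with lincomb-member vs v∈vs
  ... | cs , cs·vs≡v = 0F ∷ cs , trans (lincomb-skip w cs vs) cs·vs≡v

  record Subspace (S : SubsetV) : Set where
    field
      ∋0 : S ∋ 0V
      ∋+ : ∀ {u w} → S ∋ u → S ∋ w → S ∋ u +V w
      ∋· : ∀ c {u} → S ∋ u → S ∋ c ·V u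

  isSubspace⁻ : ∀ {S} → isSubspace S ≡ true → Subspace S
  isSubspace⁻ {S} h = record
    { ∋0 = S∋0
    ; ∋+ = λ {u} {w} S∋u S∋w →
             ⇒-true⁻ (all-true⁻ _ vectors (proj₁ (∧-true⁻ (closed-at S∋u))) (vectors-complete w)) S∋w
    ; ∋· = λ c S∋u → all-true⁻ _ elemsF (proj₂ (∧-true⁻ (closed-at S∋u))) (completeF c)
    }
    where
      S∋0 = proj₁ (∧-true⁻ h)
      closed-at : ∀ {u} → S ∋ u →
                  all (λ w → not (mem w S) ∨ mem (u +V w) S) vectors ∧ all (λ c → mem (c ·V u) S) elemsF ≡ true
      closed-at {u} S∋u = ⇒-true⁻ (all-true⁻ _ vectors (proj₂ (∧-true⁻ {mem 0V S} h)) (vectors-complete u)) S∋u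

  isSubspace⁺ : ∀ {S} → Subspace S → isSubspace S ≡ true
  isSubspace⁺ {S} sub = ∧-true⁺ ∋0 (all-true⁺ _ vectors (λ {u} _ → ⇒-true⁺ (mem u S) (λ S∋u →
    ∧-true⁺ (all-true⁺ _ vectors (λ {w} _ → ⇒-true⁺ (mem w S) (∋+ S∋u)))
            (all-true⁺ _ elemsF (λ {c} _ → ∋· c S∋u)))))
    where open Subspace sub

  ∩-subspace : ∀ {S T} → Subspace S → Subspace T → Subspace (S ∩ T)
  ∩-subspace subS subT = record
    { ∋0 = ∋-∩⁺ (S.∋0) (T.∋0)
    ; ∋+ = λ u∈ w∈ → let (Su , Tu) = ∋-∩⁻ u∈ ; (Sw , Tw) = ∋-∩⁻ w∈ in ∋-∩⁺ (S.∋+ Su Sw) (T.∋+ Tu Tw)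
    ; ∋· = λ c u∈ → let (Su , Tu) = ∋-∩⁻ u∈ in ∋-∩⁺ (S.∋· c Su) (T.∋· c Tu)
    }
    where module S = Subspace subS
          module T = Subspace subT

  Inside : ∀ {ℓ} → Vec V ℓ → SubsetV → Set
  Inside vs S = ∀ {v} → v List.∈ toList vs → S ∋ v

  Independent : ∀ {ℓ} → Vec V ℓ → Set
  Independent {ℓ} vs = ∀ cs → lincomb cs vs ≡ 0V → cs ≡ 𝟘 ℓ

  Spans : ∀ {ℓ} → Vec V ℓ → SubsetV → Set
  Spans {ℓ} vs S = ∀ {u} → S ∋ u → ∃ λ (cs : Vec F ℓ) → lincomb cs vs ≡ u

  record Basis (ℓ : ℕ) (S : SubsetV) : Set where
    field
      basis       : Vec V ℓ
      inside      : Inside basis S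
      independent : Independent basis
      spanning    : Spans basis S

  lincomb-closed : ∀ {ℓ S} → Subspace S → (vs : Vec V ℓ) → Inside vs S → ∀ cs → S ∋ lincomb cs vs
  lincomb-closed sub []       _      []       = Subspace.∋0 sub
  lincomb-closed sub (v ∷ vs) inside (c ∷ cs) =
    Subspace.∋+ sub (Subspace.∋· sub c (inside (here refl))) (lincomb-closed sub vs (inside ∘ there) cs)

  independent⁻ : ∀ {ℓ} (vs : Vec V ℓ) → linIndependent vs ≡ true → Independent vs
  independent⁻ {ℓ} vs h cs cs·vs≡0 = dec-true⁻ (≡-dec _≟F_ cs (𝟘 ℓ))
    (⇒-true⁻ (all-true⁻ _ (allVecs elemsF ℓ) h (allVecs-complete elemsF completeF ℓ cs))
             (dec-true⁺ (lincomb cs vs ≟V 0V) cs·vs≡0))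

  independent⁺ : ∀ {ℓ} (vs : Vec V ℓ) → Independent vs → linIndependent vs ≡ true
  independent⁺ {ℓ} vs ind = all-true⁺ _ (allVecs elemsF ℓ) (λ {cs} _ → ⇒-true⁺ ⌊ lincomb cs vs ≟V 0V ⌋ (λ h →
    dec-true⁺ (≡-dec _≟F_ cs (𝟘 ℓ)) (ind cs (dec-true⁻ (lincomb cs vs ≟V 0V) h))))

  inSpan : ∀ {ℓ} → Vec V ℓ → V → Bool
  inSpan {ℓ} bs w = any (λ cs → ⌊ lincomb cs bs ≟V w ⌋) (allVecs elemsF ℓ)

  inSpan⁻ : ∀ {ℓ} (bs : Vec V ℓ) {w} → inSpan bs w ≡ true → ∃ λ cs → lincomb cs bs ≡ w
  inSpan⁻ {ℓ} bs {w} h with any-true⁻ _ (allVecs elemsF ℓ) h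
  ... | cs , _ , cs·bs≡w = cs , dec-true⁻ (lincomb cs bs ≟V w) cs·bs≡w

  inSpan⁺ : ∀ {ℓ} (bs : Vec V ℓ) cs → inSpan bs (lincomb cs bs) ≡ true
  inSpan⁺ {ℓ} bs cs = any-true⁺ _ (allVecs-complete elemsF completeF ℓ cs) (dec-true⁺ (lincomb cs bs ≟V _) refl)

  spans⁻ : ∀ {ℓ} (vs : Vec V ℓ) S → spans vs S ≡ true → Spans vs S
  spans⁻ vs S h {u} S∋u = inSpan⁻ vs (⇒-true⁻ (all-true⁻ _ vectors h (vectors-complete u)) S∋u)

  spans⁺ : ∀ {ℓ} (vs : Vec V ℓ) S → Spans vs S → spans vs S ≡ true
  spans⁺ vs S sp = all-true⁺ _ vectors (λ {u} _ → ⇒-true⁺ (mem u S) (λ S∋u →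
    let (cs , cs·vs≡u) = sp S∋u in subst (λ w → inSpan vs w ≡ true) cs·vs≡u (inSpan⁺ vs cs)))

  hasDim⁻ : ∀ {ℓ S} → hasDim ℓ S ≡ true → Subspace S × Basis ℓ S
  hasDim⁻ {ℓ} {S} h with ∧-true⁻ {isSubspace S} h
  ... | sub , has-basis with any-true⁻ _ (allVecs vectors ℓ) has-basis
  ...   | vs , _ , vs-basis with ∧-true⁻ {all (λ v → mem v S) (toList vs)} vs-basis
  ...     | inside , indep-spans with ∧-true⁻ {linIndependent vs} indep-spans
  ...       | indep , spanning = isSubspace⁻ sub , record
    { basis       = vs
    ; inside      = all-true⁻ _ (toList vs) inside
    ; independent = independent⁻ vs indep
    ; spanning    = spans⁻ vs S spanning
    }

  hasDim⁺ : ∀ {ℓ S} → Subspace S → Basis ℓ S → hasDim ℓ S ≡ true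
  hasDim⁺ {ℓ} {S} sub B =
    ∧-true⁺ (isSubspace⁺ sub)
            (any-true⁺ _ (allVecs-complete vectors vectors-complete ℓ basis)
              (∧-true⁺ (all-true⁺ _ (toList basis) inside)
                       (∧-true⁺ (independent⁺ basis independent) (spans⁺ basis S spanning))))
    where open Basis B

  span : ∀ {ℓ} → Vec V ℓ → SubsetV
  span bs = tabulate (inSpan bs)

  span⁻ : ∀ {ℓ} (bs : Vec V ℓ) {w} → span bs ∋ w → ∃ λ cs → lincomb cs bs ≡ w
  span⁻ bs {w} h = inSpan⁻ bs (trans (sym (mem-tabulate (inSpan bs) w)) h)

  span⁺ : ∀ {ℓ} (bs : Vec V ℓ) cs → span bs ∋ lincomb cs bs
  span⁺ bs cs = trans (mem-tabulate (inSpan bs) _) (inSpan⁺ bs cs)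

  span-least : ∀ {ℓ S} → Subspace S → (bs : Vec V ℓ) → Inside bs S → ∀ {w} → span bs ∋ w → S ∋ w
  span-least sub bs inside h with span⁻ bs h
  ... | cs , refl = lincomb-closed sub bs inside cs

  span-subspace : ∀ {ℓ} (bs : Vec V ℓ) → Subspace (span bs)
  span-subspace {ℓ} bs = record
    { ∋0 = subst (span bs ∋_) (lincomb-zero bs) (span⁺ bs (𝟘 ℓ))
    ; ∋+ = λ u∈ w∈ → let (cs , cs·bs≡u) = span⁻ bs u∈ ; (ds , ds·bs≡w) = span⁻ bs w∈ in
             subst (span bs ∋_) (trans (lincomb-add cs ds bs) (cong₂ _+V_ cs·bs≡u ds·bs≡w)) (span⁺ bs (cs ⊕ ds))
    ; ∋· = λ c u∈ → let (cs , cs·bs≡u) = span⁻ bs u∈ in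
             subst (span bs ∋_) (trans (lincomb-scale c cs bs) (cong (c ·V_) cs·bs≡u)) (span⁺ bs (c ⊙ cs))
    }

  span-dim : ∀ {ℓ} (bs : Vec V ℓ) → Independent bs → hasDim ℓ (span bs) ≡ true
  span-dim bs ind = hasDim⁺ (span-subspace bs) (record
    { basis       = bs
    ; inside      = λ b∈bs → let (cs , cs·bs≡b) = lincomb-member bs b∈bs in
                               subst (span bs ∋_) cs·bs≡b (span⁺ bs cs)
    ; independent = ind
    ; spanning    = span⁻ bs
    })

  lincomb-injective : ∀ {ℓ} {vs : Vec V ℓ} → Independent vs →
                      ∀ {cs ds} → lincomb cs vs ≡ lincomb ds vs → cs ≡ ds
  lincomb-injective {vs = vs} ind {cs} {ds} cs·vs≡ds·vs = ⊖-cancel cs ds (ind (cs ⊕ -1F ⊙ ds) (begin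
    lincomb (cs ⊕ -1F ⊙ ds) vs               ≡⟨ lincomb-add cs (-1F ⊙ ds) vs ⟩
    lincomb cs vs ⊕ lincomb (-1F ⊙ ds) vs    ≡⟨ cong₂ _⊕_ cs·vs≡ds·vs (lincomb-scale -1F ds vs) ⟩
    lincomb ds vs ⊕ -1F ⊙ lincomb ds vs      ≡⟨ ⊕-inverse (lincomb ds vs) ⟩
    0V                                       ∎))
    where open ≡-Reasoning

  extend-independent : ∀ {ℓ} {vs : Vec V ℓ} {u} → Independent vs → (∀ cs → lincomb cs vs ≢ u) →
                       Independent (u ∷ vs)
  extend-independent {vs = vs} {u} ind u∉span (c ∷ cs) h with c ≟F 0F
  ... | yes refl = cong (0F ∷_) (ind cs (trans (sym (lincomb-skip u cs vs)) h))
  ... | no c≢0 with inverse c c≢0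
  ...   | c⁻¹ , cc⁻¹≡1 = ⊥-elim (u∉span ((c⁻¹ ·F -1F) ⊙ cs) (begin
    lincomb ((c⁻¹ ·F -1F) ⊙ cs) vs   ≡⟨ lincomb-scale (c⁻¹ ·F -1F) cs vs ⟩
    (c⁻¹ ·F -1F) ⊙ L                 ≡⟨ ⊙-assoc c⁻¹ -1F L ⟩
    c⁻¹ ⊙ (-1F ⊙ L)                  ≡⟨ cong (c⁻¹ ⊙_) (sym (⊕-inverse-unique (c ⊙ u) L h)) ⟩
    c⁻¹ ⊙ (c ⊙ u)                    ≡⟨ sym (⊙-assoc c⁻¹ c u) ⟩
    (c⁻¹ ·F c) ⊙ u                   ≡⟨ cong (_⊙ u) (trans (*-comm c⁻¹ c) cc⁻¹≡1) ⟩
    1F ⊙ u                           ≡⟨ ⊙-identity u ⟩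
    u                                ∎))
    where
      open ≡-Reasoning
      open CommutativeRing field-ring using (*-comm)
      L = lincomb cs vs

  -- Invariance of dimension: an independent list in S is no longer than a
  -- spanning list of S, since its q^p combinations are distinct elements of
  -- the q^m combinations of the spanning list.

  q≥2 : 2 ≤ q
  q≥2 = unique-length-≤ (0F ∷ 1F ∷ []) elemsF ((0≢1 All.∷ All.[]) ∷ (All.[] ∷ [])) (λ {x} _ → completeF x)

  independent≤spanning : ∀ {p m S} → Subspace S → (vs : Vec V p) → Inside vs S → Independent vs →
                         (ws : Vec V m) → Spans ws S → p ≤ m
  independent≤spanning {p} {m} sub vs inside ind ws spanning =
    ≮⇒≥ (λ m<p → <⇒≱ (^-monoʳ-< q q≥2 m<p) combinations)
    where
      combos : ∀ {ℓ} → Vec V ℓ → List V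
      combos {ℓ} bs = map (λ cs → lincomb cs bs) (allVecs elemsF ℓ)
      length-combos : ∀ {ℓ} (bs : Vec V ℓ) → length (combos bs) ≡ q ^ ℓ
      length-combos {ℓ} bs = trans (length-map _ (allVecs elemsF ℓ)) (length-allVecs elemsF ℓ)
      vs-combos-unique : Unique (combos vs)
      vs-combos-unique = map⁺ (lincomb-injective ind) (allVecs-unique elemsF uniqueF p)
      vs-combos⊆ws-combos : ∀ {x} → x List.∈ combos vs → x List.∈ combos ws
      vs-combos⊆ws-combos x∈ with ∈-map⁻ (λ cs → lincomb cs vs) x∈
      ... | cs , _ , refl with spanning (lincomb-closed sub vs inside cs)
      ...   | ds , ds·ws≡x = subst (List._∈ combos ws) ds·ws≡x
                               (∈-map⁺ (λ ds → lincomb ds ws) (allVecs-complete elemsF completeF m ds))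
      combinations : q ^ p ≤ q ^ m
      combinations = subst₂ _≤_ (length-combos vs) (length-combos ws)
                       (unique-length-≤ (combos vs) (combos ws) vs-combos-unique vs-combos⊆ws-combos)

  dim-mono : ∀ {i j U W} → hasDim i U ≡ true → hasDim j W ≡ true → U ⊆ W → i ≤ j
  dim-mono dimU dimW U⊆W with hasDim⁻ dimU | hasDim⁻ dimW
  ... | _ , BU | subW , BW =
    independent≤spanning subW U.basis (∋-⊆ U⊆W ∘ U.inside) U.independent W.basis W.spanning
    where module U = Basis BU
          module W = Basis BW

  -- Adding to a basis of v a vector of w outside v spans a subspace one
  -- dimension larger, still inside w.
  step : ∀ {j v w} → hasDim j v ≡ true → Subspace w → v ⊆ᵇ w ≡ true → w ⊆ᵇ v ≡ false →
         ∃ λ u → hasDim (suc j) u ≡ true × v ⊆ᵇ u ≡ true × u ⊆ᵇ w ≡ true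
  step {j} {v} {w} dim-v sub-w v⊆w w⊈v with hasDim⁻ dim-v | ⊈-witness (⊆ᵇ-false⁻ w⊈v)
  ... | sub-v , B | i , i∈w , i∉v =
    span bs , span-dim bs bs-independent , ⊆ᵇ⁺ (⊆-∋ v⊆span) , ⊆ᵇ⁺ (⊆-∋ (span-least sub-w bs bs-inside-w))
    where
      open Basis B
      u₀ : V
      u₀ = lookup enumeration i
      u₀∉v : ¬ v ∋ u₀
      u₀∉v v∋u₀ = i∉v (subst (_∈ v) (position-lookup i) (∋⇒∈ v∋u₀))
      bs : Vec V (suc j)
      bs = u₀ ∷ basis
      bs-independent : Independent bs
      bs-independent = extend-independent independent
        (λ cs cs·basis≡u₀ → u₀∉v (subst (v ∋_) cs·basis≡u₀ (lincomb-closed sub-v basis inside cs)))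
      v⊆span : ∀ {x} → v ∋ x → span bs ∋ x
      v⊆span v∋x = let (cs , cs·basis≡x) = spanning v∋x in
        subst (span bs ∋_) (trans (lincomb-skip u₀ cs basis) cs·basis≡x) (span⁺ bs (0F ∷ cs))
      bs-inside-w : Inside bs w
      bs-inside-w (here refl)  = ∈⇒∋ i∈w
      bs-inside-w (there b∈bs) = ∋-⊆ (⊆ᵇ⁻ v⊆w) (inside b∈bs)

  adj-irrefl : ∀ ℓ x → hasDim ℓ x ≡ true → grassmannAdj ℓ x x ≡ false
  adj-irrefl zero    x _     = refl
  adj-irrefl (suc j) x dim-x = ≢true⇒false (λ dim-x∩x →
    1+n≰n (dim-mono dim-x (subst (λ S → hasDim j S ≡ true) (∩-idem x) dim-x∩x) ⊆-refl))

  module Rank (k : ℕ) where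

    open Graded GrassmannΩ
    open Lattice GrassmannΩ k (grassmannAdj k)
    open FacetIdentity GrassmannΩ k (grassmannAdj k)

    adjacent⇔meet-facet : ∀ ℓ x y → grassmannAdj ℓ x y ≡ facetAt ℓ x (x ∩ y)
    adjacent⇔meet-facet zero    x y = refl
    adjacent⇔meet-facet (suc e) x y =
      sym (trans (cong (hasDim e (x ∩ y) ∧_) (⊆ᵇ⁺ (p∩q⊆p x y))) (∧-identityʳ _))

    conditions : MeetConditions
    conditions = record
      { elements-unique   = allVecs-unique bools bools-unique N
      ; elements-complete = allVecs-complete bools bools-complete N
      ; _≟_               = ≡-dec Data.Bool._≟_
      ; ≤ᵇ-refl           = ⊆ᵇ-refl
      ; ≤ᵇ-trans          = ⊆ᵇ-trans
      ; ≤ᵇ-antisym        = ⊆ᵇ-antisym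
      ; level-mono        = λ dimU dimW U⊆W → dim-mono dimU dimW (⊆ᵇ⁻ U⊆W)
      ; Closed            = Subspace
      ; level-closed      = λ {i} dim-u → proj₁ (hasDim⁻ {i} dim-u)
      ; step              = λ dim-v sub-w v<w → let (v⊆w , w⊈v) = <ᵇ⁻ v<w in step dim-v sub-w v⊆w w⊈v
      ; _⊓_               = _∩_
      ; ⊓-closed          = ∩-subspace
      ; ⊓-lowerˡ          = λ x y → ⊆ᵇ⁺ (p∩q⊆p x y)
      ; ⊓-lowerʳ          = λ x y → ⊆ᵇ⁺ (p∩q⊆q x y)
      ; ⊓-greatest        = λ v⊆x v⊆y → ⊆ᵇ⁺ (⊆-∩ (⊆ᵇ⁻ v⊆x) (⊆ᵇ⁻ v⊆y))
      ; adj-irrefl        = λ {x} → adj-irrefl k x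
      ; adj-meet          = λ {x} {y} _ _ _ → adjacent⇔meet-facet k x y
      }

    grassmann : GrassmannClaim 𝔽 n k
    grassmann = facet-identity conditions

-- Each graph satisfies the conditions of FacetIdentity (the Johnson case does
-- not need the hypothesis 2k ≤ n).
lemma4p11 : ((n k : ℕ) → 2 * k ≤ n → JohnsonClaim n k)
            × ((𝔽 : FiniteField) (n k : ℕ) → GrassmannClaim 𝔽 n k)
            × ((n : ℕ) → HypercubeClaim n)
lemma4p11 = (λ n k _ → JohnsonGraph.johnson n k)
          , (λ 𝔽 n k → GrassmannGraph.Rank.grassmann 𝔽 n k)
          , HypercubeGraph.hypercube
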